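{- For any $(s_1,\dots,s_r)\in\mathbb{Z}^r$, any $0\leq M\leq r$ and any $N\in\mathbb{N}$, the element \[ \left(\sum_{\deg P>d_1>\cdots>d_M\geq N>d_{M+1}>\cdots>d_r\geq0}S_{d_1}(s_1)\cdots S_{d_r}(s_r)\right)_P \] of $\mathcal{A}_k$ is a $k$-linear combination of finite multiple zeta values of depth at most $r$.
   Context: Fix a prime $p$ and a power $q$ of $p$; $A=\mathbb{F}_q[\theta]$, $k=\mathbb{F}_q(\theta)$. For $d\in\mathbb{N}$ and $s\in\mathbb{Z}$, $S_d(s)=\sum_a a^{ -s}\in k$, the sum over all monic $a\in A$ of degree $d$. $\mathcal{A}_k=\prod_PA/(P)/\bigoplus_PA/(P)$, $P$ running over monic irreducible polynomials of $A$, a $k$-algebra; the displayed element is the class of the tuple whose $P$-component is the indicated sum reduced mod $P$. For $\mathbf{s}=(s_1,\dots,s_r)\in\mathbb{Z}^r$, the finite multiple zeta value (of depth $r$) $\zeta_{\mathcal{A}_k}(\mathbf{s})\in\mathcal{A}_k$ has $P$-component $\sum\frac{1}{a_1^{s_1}\cdots a_r^{s_r}}\in A/(P)$ over monic $a_i$ with $\deg P>\deg a_1>\cdots>\deg a_r\geq0$, i.e. $\sum_{\deg P>d_1>\cdots>d_r\geq0}S_{d_1}(s_1)\cdots S_{d_r}(s_r)$; the depth-$0$ value is $1$. -}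

module Defs where

open import Level using (Level; _⊔_) renaming (suc to lsuc)
open import Algebra.Bundles using (CommutativeRing)
open import Data.Bool using (Bool; true; false; _∧_; if_then_else_)
open import Data.Nat as ℕ using (ℕ; zero; suc; _≤ᵇ_; _<ᵇ_)
open import Data.Integer using (ℤ; +_; -[1+_])
open import Data.List as L using (List; []; _∷_; _++_; [_]; map; concatMap; upTo; foldr; zipWith; length; take; drop; filterᵇ)
open import Data.List.Relation.Unary.Any using (Any)
open import Data.List.Relation.Unary.All using (All)
open import Data.Product using (Σ; _×_; _,_; proj₁; proj₂)
open import Data.Sum using (_⊎_)
open import Relation.Nullary using (¬_; yes; no)
open import Relation.Binary using (Decidable)
open import Relation.Binary.PropositionalEquality using (_≡_)
import Data.List.Relation.Unary.Unique.Setoid as UniqueS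

record FiniteField (c ℓ : Level) : Set (lsuc (c ⊔ ℓ)) where
  field
    commRing : CommutativeRing c ℓ
  open CommutativeRing commRing public
  field
    _≟_      : Decidable _≈_
    0≉1      : ¬ (0# ≈ 1#)
    inverse  : ∀ x → ¬ (x ≈ 0#) → Σ Carrier (λ y → (x * y) ≈ 1#)
    elements : List Carrier
    complete : ∀ x → Any (x ≈_) elements
    unique   : UniqueS.Unique setoid elements

module FF {c ℓ : Level} (F : FiniteField c ℓ) where
  open FiniteField F

  -- A = F_q[θ]: polynomials as coefficient lists, lowest degree first.

  Poly : Set c
  Poly = List Carrier

  coeff : Poly → ℕ → Carrier
  coeff []       _       = 0#
  coeff (a ∷ f)  zero    = a
  coeff (a ∷ f)  (suc n) = coeff f n

  _≈ₚ_ : Poly → Poly → Set ℓ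
  f ≈ₚ g = ∀ n → coeff f n ≈ coeff g n

  isZeroᵇ : Carrier → Bool
  isZeroᵇ x with x ≟ 0#
  ... | yes _ = true
  ... | no  _ = false

  normalize : Poly → Poly
  normalize [] = []
  normalize (a ∷ f) with normalize f
  ... | [] = if isZeroᵇ a then [] else a ∷ []
  ... | g  = a ∷ g

  -- degree (the zero polynomial is given degree 0; never used for it)
  deg : Poly → ℕ
  deg f = length (normalize f) ℕ.∸ 1

  leading : Poly → Carrier
  leading f = coeff f (deg f)

  _+ₚ_ : Poly → Poly → Poly
  []      +ₚ g       = g
  f       +ₚ []      = f
  (a ∷ f) +ₚ (b ∷ g) = (a + b) ∷ (f +ₚ g)

  negₚ : Poly → Poly
  negₚ = map (-_)

  _-ₚ_ : Poly → Poly → Poly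
  f -ₚ g = f +ₚ negₚ g

  scale : Carrier → Poly → Poly
  scale a = map (a *_)

  _*ₚ_ : Poly → Poly → Poly
  []      *ₚ g = []
  (a ∷ f) *ₚ g = scale a g +ₚ (0# ∷ (f *ₚ g))

  oneₚ : Poly
  oneₚ = 1# ∷ []

  _^ₚ_ : Poly → ℕ → Poly
  f ^ₚ zero  = oneₚ
  f ^ₚ suc n = f *ₚ (f ^ₚ n)

  _∣ₚ_ : Poly → Poly → Set (c ⊔ ℓ)
  P ∣ₚ f = Σ Poly (λ g → (P *ₚ g) ≈ₚ f)

  Monic : Poly → Set ℓ
  Monic f = leading f ≈ 1#

  MonicIrreducible : Poly → Set (c ⊔ ℓ)
  MonicIrreducible P =
    Monic P × (1 ℕ.≤ deg P) ×
    (∀ g h → (g *ₚ h) ≈ₚ P → (deg g ≡ 0) ⊎ (deg h ≡ 0))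

  tuples : ℕ → List (List Carrier)
  tuples zero    = [ [] ]
  tuples (suc n) = concatMap (λ x → map (x ∷_) (tuples n)) elements

  monicOfDeg : ℕ → List Poly
  monicOfDeg d = map (_++ [ 1# ]) (tuples d)

  -- k = F_q(θ): fractions num/den.

  Frac : Set c
  Frac = Poly × Poly

  num den : Frac → Poly
  num = proj₁
  den = proj₂

  K : Set (c ⊔ ℓ)
  K = Σ Frac (λ x → ¬ (den x ≈ₚ []))

  _+f_ : Frac → Frac → Frac
  (a , b) +f (c' , d) = ((a *ₚ d) +ₚ (c' *ₚ b)) , (b *ₚ d)

  _*f_ : Frac → Frac → Frac
  (a , b) *f (c' , d) = (a *ₚ c') , (b *ₚ d)

  0f 1f : Frac
  0f = [] , oneₚ
  1f = oneₚ , oneₚ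

  sumF : List Frac → Frac
  sumF = foldr _+f_ 0f

  prodF : List Frac → Frac
  prodF = foldr _*f_ 1f

  invPow : Poly → ℤ → Frac
  invPow a (+ n)    = oneₚ , (a ^ₚ n)
  invPow a -[1+ n ] = (a ^ₚ suc n) , oneₚ

  S : ℕ → ℤ → Frac
  S d s = sumF (map (λ a → invPow a s) (monicOfDeg d))

  chains : ℕ → ℕ → List (List ℕ)
  chains h zero    = [ [] ]
  chains h (suc r) = concatMap (λ d → map (d ∷_) (chains d r)) (upTo h)

  termF : List ℤ → List ℕ → Frac
  termF s ds = prodF (zipWith S ds s)

  -- P-component of the finite MZV ζ_{A_k}(s):
  -- Σ_{deg P > d₁ > ⋯ > d_r ≥ 0} S_{d₁}(s₁)⋯S_{d_r}(s_r)
  ζcomp : List ℤ → Poly → Frac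
  ζcomp s P = sumF (map (termF s) (chains (deg P) (length s)))

  allᵇ : {A : Set} → (A → Bool) → List A → Bool
  allᵇ p []       = true
  allᵇ p (x ∷ xs) = p x ∧ allᵇ p xs

  splitCond : ℕ → ℕ → List ℕ → Bool
  splitCond M N ds = allᵇ (N ≤ᵇ_) (take M ds) ∧ allᵇ (_<ᵇ N) (drop M ds)

  splitComp : List ℤ → ℕ → ℕ → Poly → Frac
  splitComp s M N P =
    sumF (map (termF s) (filterᵇ (splitCond M N) (chains (deg P) (length s))))

  -- A_k = Π_P A/(P) / ⊕_P A/(P).
  -- Fractions x, y (denominators prime to P) have equal images in A/(P):
  SameModP : Poly → Frac → Frac → Set (c ⊔ ℓ)
  SameModP P x y =
    ¬ (P ∣ₚ den x) × ¬ (P ∣ₚ den y) ×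
    (P ∣ₚ ((num x *ₚ den y) -ₚ (num y *ₚ den x)))

  EqAk : (Poly → Frac) → (Poly → Frac) → Set (c ⊔ ℓ)
  EqAk x y =
    Σ (List Poly) λ E →
      ∀ P → MonicIrreducible P → ¬ Any (P ≈ₚ_) E → SameModP P (x P) (y P)

  KLinCombFMZV : ℕ → (Poly → Frac) → Set (c ⊔ ℓ)
  KLinCombFMZV r x =
    Σ (List (K × List ℤ)) λ L →
      All (λ cs → length (proj₂ cs) ℕ.≤ r) L ×
      EqAk x (λ P → sumF (map (λ cs → proj₁ (proj₁ cs) *f ζcomp (proj₂ cs) P) L))

-- Let P have degree n > N.  Cutting a chain n > d₁ > ⋯ > d_r ≥ 0 at N factors the sum as
--   (Σ_{n > d₁ > ⋯ > d_M ≥ N} S_{d₁}(s₁)⋯S_{d_M}(s_M)) · ζ_{<N}(s_{M+1}, …, s_r),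
-- and the second factor is an element of k independent of P.  The first factor is, by induction
-- on M, a combination Σ a_u ζ_{<n}(u) with coefficients a_u ∈ k independent of P and depth u ≤ M:
-- summing over the largest index d₁ first and using
--   Σ_{N ≤ d < n} S_d(t) ζ_{<d}(u) = ζ_{<n}(t, u) - ζ_{<N}(t, u).
-- These identities hold for any family g in place of S in any commutative ring.  They are applied
-- in the residue field of A at (P), where every S_d(s) with d < n is integral, and so become
-- congruences mod P; the coefficients are computed in the residue field at (0), which is k.

module Submission where

open import Defs
open import Level using (Level; _⊔_) renaming (suc to lsuc)
open import Algebra.Bundles using (CommutativeRing)
open import Algebra.Bundles.Raw using (RawRing)
open import Data.Bool using (Bool; true; false; T; _∧_; if_then_else_)
open import Data.Empty using (⊥; ⊥-elim)
open import Data.Integer using (ℤ; +_; -[1+_])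
open import Data.List
  using (List; []; _∷_; _++_; [_]; map; foldr; zipWith; length; take; drop; concatMap; upTo; filterᵇ)
import Data.List.Properties as List
open import Data.List.Relation.Unary.All as All using (All; []; _∷_)
import Data.List.Relation.Unary.All.Properties as All
open import Data.List.Relation.Unary.Any as Any using (Any; here)
open import Data.List.Membership.Propositional.Properties using (∈-upTo⁺)
import Data.List.Relation.Unary.Any.Properties as Any
open import Data.Nat as ℕ using (ℕ; zero; suc; _≤_; _<_; z≤n; s≤s; _≤ᵇ_; _<ᵇ_)
import Data.Nat.Properties as ℕ
open import Data.Product using (Σ; _×_; _,_; proj₁; proj₂; map₁; map₂)
open import Data.Sum using (_⊎_; inj₁; inj₂)
open import Data.Unit using (tt)
open import Function using (_∘_)
open import Relation.Nullary using (¬_; Dec; yes; no)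
open import Relation.Unary using (Decidable)
open import Relation.Binary.PropositionalEquality as ≡ using (_≡_)
open import Relation.Binary.Definitions using (tri<; tri≈; tri>)

private variable
  x y : Level
  X : Set x
  Y : Set y

module RawSum {c ℓ} (R : RawRing c ℓ) where
  open RawRing R

  ∑ : List X → (X → Carrier) → Carrier
  ∑ l f = foldr _+_ 0# (map f l)

module SumProperties {c ℓ} (R : CommutativeRing c ℓ) where
  open CommutativeRing R hiding (zero)
  open RawSum rawRing public
  open import Algebra.Properties.Ring ring using (-1*x≈-x)
  open import Algebra.Solver.Ring.NaturalCoefficients.Default commutativeSemiring
  open import Relation.Binary.Reasoning.Setoid setoid

  ∑-cong : (l : List X) {f h : X → Carrier} → (∀ x → f x ≈ h x) → ∑ l f ≈ ∑ l h
  ∑-cong []      f≈h = refl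
  ∑-cong (x ∷ l) f≈h = +-cong (f≈h x) (∑-cong l f≈h)

  ∑-++ : (l m : List X) (f : X → Carrier) → ∑ (l ++ m) f ≈ ∑ l f + ∑ m f
  ∑-++ []      m f = sym (+-identityˡ _)
  ∑-++ (x ∷ l) m f = trans (+-cong refl (∑-++ l m f)) (sym (+-assoc _ _ _))

  ∑-map : (h : X → Y) (l : List X) (f : Y → Carrier) → ∑ (map h l) f ≈ ∑ l (f ∘ h)
  ∑-map h l f = reflexive (≡.cong (foldr _+_ 0#) (≡.sym (List.map-∘ l)))

  ∑-concatMap : (h : X → List Y) (l : List X) (f : Y → Carrier) →
                ∑ (concatMap h l) f ≈ ∑ l (λ x → ∑ (h x) f)
  ∑-concatMap h []      f = refl
  ∑-concatMap h (x ∷ l) f = trans (∑-++ (h x) _ f) (+-cong refl (∑-concatMap h l f))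

  ∑-zero : (l : List X) → ∑ l (λ _ → 0#) ≈ 0#
  ∑-zero []      = refl
  ∑-zero (x ∷ l) = trans (+-cong refl (∑-zero l)) (+-identityʳ _)

  ∑-+ : (l : List X) (f h : X → Carrier) → ∑ l (λ x → f x + h x) ≈ ∑ l f + ∑ l h
  ∑-+ []      f h = sym (+-identityʳ _)
  ∑-+ (x ∷ l) f h = trans (+-cong refl (∑-+ l f h))
    (solve 4 (λ a b c d → (a :+ b) :+ (c :+ d) := (a :+ c) :+ (b :+ d)) refl (f x) (h x) _ _)

  ∑-*ˡ : (l : List X) (z : Carrier) (f : X → Carrier) → ∑ l (λ x → z * f x) ≈ z * ∑ l f
  ∑-*ˡ []      z f = sym (zeroʳ z)
  ∑-*ˡ (x ∷ l) z f = trans (+-cong refl (∑-*ˡ l z f)) (sym (distribˡ z _ _))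

  ∑-*ʳ : (l : List X) (z : Carrier) (f : X → Carrier) → ∑ l (λ x → f x * z) ≈ ∑ l f * z
  ∑-*ʳ l z f = trans (∑-cong l (λ x → *-comm (f x) z)) (trans (∑-*ˡ l z f) (*-comm _ _))

  ∑-neg : (l : List X) (f : X → Carrier) → ∑ l (λ x → - f x) ≈ - ∑ l f
  ∑-neg l f = begin
    ∑ l (λ x → - f x)      ≈⟨ ∑-cong l (λ x → sym (-1*x≈-x (f x))) ⟩
    ∑ l (λ x → - 1# * f x) ≈⟨ ∑-*ˡ l (- 1#) f ⟩
    - 1# * ∑ l f           ≈⟨ -1*x≈-x _ ⟩
    - ∑ l f                ∎

  ∑-swap : (l : List X) (m : List Y) (f : X → Y → Carrier) →
           ∑ l (λ x → ∑ m (f x)) ≈ ∑ m (λ y → ∑ l (λ x → f x y))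
  ∑-swap []      m f = sym (∑-zero m)
  ∑-swap (x ∷ l) m f = trans (+-cong refl (∑-swap l m f)) (sym (∑-+ m (f x) _))

  when : Bool → Carrier → Carrier
  when b v = if b then v else 0#

  when-cong : ∀ b {u v} → u ≈ v → when b u ≈ when b v
  when-cong true  u≈v = u≈v
  when-cong false u≈v = refl

  when-*ˡ : ∀ b u v → when b (u * v) ≈ u * when b v
  when-*ˡ true  u v = refl
  when-*ˡ false u v = sym (zeroʳ u)

  ∑-when : (l : List X) (b : Bool) (f : X → Carrier) → ∑ l (λ x → when b (f x)) ≈ when b (∑ l f)
  ∑-when l true  f = refl
  ∑-when l false f = ∑-zero l

  ∑-filterᵇ : (p : X → Bool) (l : List X) (f : X → Carrier) →
              ∑ (filterᵇ p l) f ≈ ∑ l (λ x → when (p x) (f x))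
  ∑-filterᵇ p []      f = refl
  ∑-filterᵇ p (x ∷ l) f with p x
  ... | true  = +-cong refl (∑-filterᵇ p l f)
  ... | false = trans (∑-filterᵇ p l f) (sym (+-identityˡ _))

  ∑< : ℕ → (ℕ → Carrier) → Carrier
  ∑< h = ∑ (upTo h)

  ∑<-suc : ∀ h f → ∑< (suc h) f ≈ ∑< h f + f h
  ∑<-suc h f = begin
    ∑ (upTo (suc h)) f        ≡⟨ ≡.cong (λ l → ∑ l f) (≡.sym (List.upTo-∷ʳ h)) ⟩
    ∑ (upTo h ++ [ h ]) f     ≈⟨ ∑-++ (upTo h) [ h ] f ⟩
    ∑< h f + (f h + 0#)       ≈⟨ +-cong refl (+-identityʳ _) ⟩
    ∑< h f + f h              ∎

  ∑<-cong : ∀ h {f f′} → (∀ d → d < h → f d ≈ f′ d) → ∑< h f ≈ ∑< h f′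
  ∑<-cong zero    f≈f′ = refl
  ∑<-cong (suc h) {f} {f′} f≈f′ = begin
    ∑< (suc h) f    ≈⟨ ∑<-suc h f ⟩
    ∑< h f + f h    ≈⟨ +-cong (∑<-cong h (λ d d<h → f≈f′ d (ℕ.m<n⇒m<1+n d<h))) (f≈f′ h ℕ.≤-refl) ⟩
    ∑< h f′ + f′ h  ≈⟨ sym (∑<-suc h f′) ⟩
    ∑< (suc h) f′   ∎

  when-T : ∀ b → T b → ∀ v → when b v ≈ v
  when-T true _ v = refl

  when-¬T : ∀ b → ¬ T b → ∀ v → when b v ≈ 0#
  when-¬T true  ¬t v = ⊥-elim (¬t tt)
  when-¬T false ¬t v = refl

  when-complement : ∀ N d v → when (N ≤ᵇ d) v + when (d <ᵇ N) v ≈ v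
  when-complement N d v with N ℕ.≤? d
  ... | yes N≤d = trans (+-cong (when-T (N ≤ᵇ d) (ℕ.≤⇒≤ᵇ N≤d) v)
                                (when-¬T (d <ᵇ N) (λ t → ℕ.<⇒≱ (ℕ.<ᵇ⇒< d N t) N≤d) v))
                        (+-identityʳ v)
  ... | no N≰d  = trans (+-cong (when-¬T (N ≤ᵇ d) (N≰d ∘ ℕ.≤ᵇ⇒≤ N d) v)
                                (when-T (d <ᵇ N) (ℕ.<⇒<ᵇ (ℕ.≰⇒> N≰d)) v))
                        (+-identityˡ v)

  ∑<-below : ∀ N h f → N ≤ h → ∑< h (λ d → when (d <ᵇ N) (f d)) ≈ ∑< N f
  ∑<-below N zero    f z≤n = refl
  ∑<-below N (suc h) f N≤1+h with N ℕ.≟ suc h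
  ... | yes ≡.refl = ∑<-cong (suc h) (λ d d<N → when-T (d <ᵇ N) (ℕ.<⇒<ᵇ d<N) (f d))
  ... | no  N≢1+h  = begin
    ∑< (suc h) (λ d → when (d <ᵇ N) (f d))
      ≈⟨ ∑<-suc h _ ⟩
    ∑< h (λ d → when (d <ᵇ N) (f d)) + when (h <ᵇ N) (f h)
      ≈⟨ +-cong (∑<-below N h f N≤h) (when-¬T (h <ᵇ N) (λ t → ℕ.<⇒≱ (ℕ.<ᵇ⇒< h N t) N≤h) (f h)) ⟩
    ∑< N f + 0#
      ≈⟨ +-identityʳ _ ⟩
    ∑< N f ∎
    where
    N≤h : N ≤ h
    N≤h = ℕ.s≤s⁻¹ (ℕ.≤∧≢⇒< N≤1+h N≢1+h)

  ∑<-above : ∀ N h f → N ≤ h → ∑< h (λ d → when (N ≤ᵇ d) (f d)) ≈ ∑< h f - ∑< N f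
  ∑<-above N h f N≤h = begin
    high                         ≈⟨ sym (+-identityʳ high) ⟩
    high + 0#                    ≈⟨ +-cong refl (sym (-‿inverseʳ (∑< N f))) ⟩
    high + (∑< N f - ∑< N f)     ≈⟨ sym (+-assoc _ _ _) ⟩
    (high + ∑< N f) - ∑< N f     ≈⟨ +-cong high+low refl ⟩
    ∑< h f - ∑< N f              ∎
    where
    high = ∑< h (λ d → when (N ≤ᵇ d) (f d))
    high+low : high + ∑< N f ≈ ∑< h f
    high+low = begin
      high + ∑< N f
        ≈⟨ +-cong refl (sym (∑<-below N h f N≤h)) ⟩
      high + ∑< h (λ d → when (d <ᵇ N) (f d))
        ≈⟨ sym (∑-+ (upTo h) _ _) ⟩
      ∑< h (λ d → when (N ≤ᵇ d) (f d) + when (d <ᵇ N) (f d))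
        ≈⟨ ∑-cong (upTo h) (λ d → when-complement N d (f d)) ⟩
      ∑< h f ∎

record DecPrimeIdeal {c ℓ} (R : CommutativeRing c ℓ) (i : Level) : Set (c ⊔ ℓ ⊔ lsuc i) where
  open CommutativeRing R hiding (zero)
  field
    𝔭        : Carrier → Set i
    𝔭-resp-≈ : ∀ {x y} → x ≈ y → 𝔭 x → 𝔭 y
    0∈𝔭      : 𝔭 0#
    𝔭-+      : ∀ {x y} → 𝔭 x → 𝔭 y → 𝔭 (x + y)
    𝔭-*ˡ     : ∀ z {x} → 𝔭 x → 𝔭 (z * x)
    1∉𝔭      : ¬ 𝔭 1#
    𝔭-prime  : ∀ {x y} → ¬ 𝔭 x → ¬ 𝔭 y → ¬ 𝔭 (x * y)
    𝔭?       : Decidable 𝔭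

-- κ(𝔭) = R_𝔭 / 𝔭R_𝔭: fractions with denominator outside 𝔭, where n/d and n′/d′ are
-- identified when n d′ - n′ d ∈ 𝔭.
module ResidueRing {c ℓ i} {R : CommutativeRing c ℓ} (𝔓 : DecPrimeIdeal R i) where
  open CommutativeRing R hiding (zero)
  open DecPrimeIdeal 𝔓
  open import Algebra.Properties.Ring ring using (-1*x≈-x; -‿distribˡ-*; x[y-z]≈xy-xz)
  open import Algebra.Properties.AbelianGroup +-abelianGroup using (⁻¹-anti-homo‿-; ⁻¹-∙-comm)
  open import Algebra.Properties.Group +-group using (x≈y⇒x∙y⁻¹≈ε)
  open import Algebra.Solver.Ring.NaturalCoefficients.Default commutativeSemiring
  open import Relation.Binary.Reasoning.Setoid setoid

  infix 4 _≡𝔭_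
  _≡𝔭_ : Carrier → Carrier → Set i
  x ≡𝔭 y = 𝔭 (x - y)

  𝔭-neg : ∀ {x} → 𝔭 x → 𝔭 (- x)
  𝔭-neg {x} x∈𝔭 = 𝔭-resp-≈ (-1*x≈-x x) (𝔭-*ˡ (- 1#) x∈𝔭)

  ≈⇒≡𝔭 : ∀ {x y} → x ≈ y → x ≡𝔭 y
  ≈⇒≡𝔭 x≈y = 𝔭-resp-≈ (sym (x≈y⇒x∙y⁻¹≈ε x≈y)) 0∈𝔭

  ≡𝔭-sym : ∀ {x y} → x ≡𝔭 y → y ≡𝔭 x
  ≡𝔭-sym {x} {y} x≡y = 𝔭-resp-≈ (⁻¹-anti-homo‿- x y) (𝔭-neg x≡y)

  ≡𝔭-trans : ∀ {x y z} → x ≡𝔭 y → y ≡𝔭 z → x ≡𝔭 z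
  ≡𝔭-trans {x} {y} {z} x≡y y≡z = 𝔭-resp-≈ telescope (𝔭-+ x≡y y≡z)
    where
    telescope : (x - y) + (y - z) ≈ x - z
    telescope = begin
      (x - y) + (y - z)   ≈⟨ solve 4 (λ a -b b -c → (a :+ -b) :+ (b :+ -c) := (a :+ -c) :+ (b :+ -b))
                                    refl x (- y) y (- z) ⟩
      (x - z) + (y - y)   ≈⟨ +-cong refl (-‿inverseʳ y) ⟩
      (x - z) + 0#        ≈⟨ +-identityʳ _ ⟩
      x - z               ∎

  ≡𝔭-+ : ∀ {x y u v} → x ≡𝔭 y → u ≡𝔭 v → x + u ≡𝔭 y + v
  ≡𝔭-+ {x} {y} {u} {v} x≡y u≡v = 𝔭-resp-≈ regroup (𝔭-+ x≡y u≡v)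
    where
    regroup : (x - y) + (u - v) ≈ (x + u) - (y + v)
    regroup = begin
      (x - y) + (u - v)     ≈⟨ solve 4 (λ a -b c -d → (a :+ -b) :+ (c :+ -d) := (a :+ c) :+ (-b :+ -d))
                                      refl x (- y) u (- v) ⟩
      (x + u) + (- y - v)   ≈⟨ +-cong refl (⁻¹-∙-comm y v) ⟩
      (x + u) - (y + v)     ∎

  ≡𝔭-*ˡ : ∀ z {x y} → x ≡𝔭 y → z * x ≡𝔭 z * y
  ≡𝔭-*ˡ z {x} {y} x≡y = 𝔭-resp-≈ (x[y-z]≈xy-xz z x y) (𝔭-*ˡ z x≡y)

  ≡𝔭-*ʳ : ∀ z {x y} → x ≡𝔭 y → x * z ≡𝔭 y * z
  ≡𝔭-*ʳ z {x} {y} x≡y = 𝔭-resp-≈ (+-cong (*-comm z x) (-‿cong (*-comm z y))) (≡𝔭-*ˡ z x≡y)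

  ≡𝔭-neg : ∀ {x y} → x ≡𝔭 y → - x ≡𝔭 - y
  ≡𝔭-neg {x} {y} x≡y = 𝔭-resp-≈ (sym (⁻¹-∙-comm x (- y))) (𝔭-neg x≡y)

  ≡𝔭-resp-≈ : ∀ {x x′ y y′} → x ≈ x′ → y ≈ y′ → x ≡𝔭 y → x′ ≡𝔭 y′
  ≡𝔭-resp-≈ x≈x′ y≈y′ x≡y = ≡𝔭-trans (≈⇒≡𝔭 (sym x≈x′)) (≡𝔭-trans x≡y (≈⇒≡𝔭 y≈y′))

  -- decidability of 𝔭 turns ¬ ¬ (x ≡𝔭 y) into x ≡𝔭 y
  ≡𝔭-cancelˡ : ∀ d {x y} → ¬ 𝔭 d → d * x ≡𝔭 d * y → x ≡𝔭 y
  ≡𝔭-cancelˡ d {x} {y} d∉𝔭 dx≡dy with 𝔭? (x - y)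
  ... | yes x≡y = x≡y
  ... | no  x≢y = ⊥-elim (𝔭-prime d∉𝔭 x≢y (𝔭-resp-≈ (sym (x[y-z]≈xy-xz d x y)) dx≡dy))

  Fraction : Set (c ⊔ i)
  Fraction = Σ (Carrier × Carrier) (λ nd → ¬ 𝔭 (proj₂ nd))

  infix 4 _≃_
  _≃_ : Fraction → Fraction → Set i
  ((n , d) , _) ≃ ((n′ , d′) , _) = n * d′ ≡𝔭 n′ * d

  infixl 6 _⊕_
  infixl 7 _⊗_
  _⊕_ _⊗_ : Fraction → Fraction → Fraction
  ((n , d) , d∉𝔭) ⊕ ((n′ , d′) , d′∉𝔭) = ((n * d′ + n′ * d) , d * d′) , 𝔭-prime d∉𝔭 d′∉𝔭
  ((n , d) , d∉𝔭) ⊗ ((n′ , d′) , d′∉𝔭) = ((n * n′) , d * d′) , 𝔭-prime d∉𝔭 d′∉𝔭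

  ⊖_ : Fraction → Fraction
  ⊖ ((n , d) , d∉𝔭) = ((- n) , d) , d∉𝔭

  𝟘 𝟙 : Fraction
  𝟘 = (0# , 1#) , 1∉𝔭
  𝟙 = (1# , 1#) , 1∉𝔭

  ≃-refl : ∀ {x} → x ≃ x
  ≃-refl = ≈⇒≡𝔭 refl

  ≃-sym : ∀ {x y} → x ≃ y → y ≃ x
  ≃-sym = ≡𝔭-sym

  ≃-trans : ∀ {x y z} → x ≃ y → y ≃ z → x ≃ z
  ≃-trans {(a , b) , _} {(c′ , d) , d∉𝔭} {(e , f) , _} ad≡cb cf≡ed =
    ≡𝔭-cancelˡ d d∉𝔭
      (≡𝔭-resp-≈ (solve 3 (λ a d f → (a :* d) :* f := d :* (a :* f)) refl a d f)
                 (solve 3 (λ e d b → (e :* d) :* b := d :* (e :* b)) refl e d b)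
        (≡𝔭-trans (≡𝔭-*ʳ f ad≡cb)
          (≡𝔭-trans (≈⇒≡𝔭 (solve 3 (λ c b f → (c :* b) :* f := (c :* f) :* b) refl c′ b f))
            (≡𝔭-*ʳ b cf≡ed))))

  ⊕-cong : ∀ {x x′ y y′} → x ≃ x′ → y ≃ y′ → x ⊕ y ≃ x′ ⊕ y′
  ⊕-cong {(a , b) , _} {(a′ , b′) , _} {(c′ , d) , _} {(c″ , d′) , _} p q =
    ≡𝔭-resp-≈
      (solve 6 (λ a b c d b′ d′ → (a :* b′) :* (d :* d′) :+ (c :* d′) :* (b :* b′)
                                := (a :* d :+ c :* b) :* (b′ :* d′)) refl a b c′ d b′ d′)
      (solve 6 (λ a′ b c′ d b′ d′ → (a′ :* b) :* (d :* d′) :+ (c′ :* d) :* (b :* b′)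
                                  := (a′ :* d′ :+ c′ :* b′) :* (b :* d)) refl a′ b c″ d b′ d′)
      (≡𝔭-+ (≡𝔭-*ʳ (d * d′) p) (≡𝔭-*ʳ (b * b′) q))

  ⊗-cong : ∀ {x x′ y y′} → x ≃ x′ → y ≃ y′ → x ⊗ y ≃ x′ ⊗ y′
  ⊗-cong {(a , b) , _} {(a′ , b′) , _} {(c′ , d) , _} {(c″ , d′) , _} p q =
    ≡𝔭-resp-≈
      (solve 6 (λ a b′ c d′ b d → (a :* b′) :* (c :* d′) := (a :* c) :* (b′ :* d′)) refl a b′ c′ d′ b d)
      (solve 6 (λ a′ b c′ d b′ d′ → (a′ :* b) :* (c′ :* d) := (a′ :* c′) :* (b :* d)) refl a′ b c″ d b′ d′)
      (≡𝔭-trans (≡𝔭-*ʳ (c′ * d′) p) (≡𝔭-*ˡ (a′ * b) q))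

  ⊖-cong : ∀ {x x′} → x ≃ x′ → ⊖ x ≃ ⊖ x′
  ⊖-cong {(a , b) , _} {(a′ , b′) , _} p =
    ≡𝔭-resp-≈ (-‿distribˡ-* a b′) (-‿distribˡ-* a′ b) (≡𝔭-neg p)

  ⊕-assoc : ∀ x y z → (x ⊕ y) ⊕ z ≃ x ⊕ (y ⊕ z)
  ⊕-assoc ((a , b) , _) ((c′ , d) , _) ((e , f) , _) = ≈⇒≡𝔭
    (solve 6 (λ a b c d e f → ((a :* d :+ c :* b) :* f :+ e :* (b :* d)) :* (b :* (d :* f))
                            := (a :* (d :* f) :+ (c :* f :+ e :* d) :* b) :* ((b :* d) :* f))
           refl a b c′ d e f)

  ⊕-comm : ∀ x y → x ⊕ y ≃ y ⊕ x
  ⊕-comm ((a , b) , _) ((c′ , d) , _) = ≈⇒≡𝔭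
    (solve 4 (λ a b c d → (a :* d :+ c :* b) :* (d :* b) := (c :* b :+ a :* d) :* (b :* d)) refl a b c′ d)

  ⊕-identityˡ : ∀ x → 𝟘 ⊕ x ≃ x
  ⊕-identityˡ ((a , b) , _) = ≈⇒≡𝔭
    (solve 2 (λ a b → (con 0 :* b :+ a :* con 1) :* b := a :* (con 1 :* b)) refl a b)

  ⊕-identityʳ : ∀ x → x ⊕ 𝟘 ≃ x
  ⊕-identityʳ ((a , b) , _) = ≈⇒≡𝔭
    (solve 2 (λ a b → (a :* con 1 :+ con 0 :* b) :* b := a :* (b :* con 1)) refl a b)

  ⊕-inverseʳ : ∀ x → x ⊕ ⊖ x ≃ 𝟘
  ⊕-inverseʳ ((a , b) , _) = ≈⇒≡𝔭 (begin
    (a * b + (- a) * b) * 1#   ≈⟨ *-identityʳ _ ⟩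
    a * b + (- a) * b          ≈⟨ +-cong refl (sym (-‿distribˡ-* a b)) ⟩
    a * b - a * b              ≈⟨ -‿inverseʳ _ ⟩
    0#                         ≈⟨ sym (zeroˡ _) ⟩
    0# * (b * b)               ∎)

  ⊕-inverseˡ : ∀ x → ⊖ x ⊕ x ≃ 𝟘
  ⊕-inverseˡ x = ≃-trans {⊖ x ⊕ x} {x ⊕ ⊖ x} {𝟘} (⊕-comm (⊖ x) x) (⊕-inverseʳ x)

  ⊗-assoc : ∀ x y z → (x ⊗ y) ⊗ z ≃ x ⊗ (y ⊗ z)
  ⊗-assoc ((a , b) , _) ((c′ , d) , _) ((e , f) , _) = ≈⇒≡𝔭
    (solve 6 (λ a b c d e f → ((a :* c) :* e) :* (b :* (d :* f)) := (a :* (c :* e)) :* ((b :* d) :* f))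
           refl a b c′ d e f)

  ⊗-comm : ∀ x y → x ⊗ y ≃ y ⊗ x
  ⊗-comm ((a , b) , _) ((c′ , d) , _) = ≈⇒≡𝔭
    (solve 4 (λ a b c d → (a :* c) :* (d :* b) := (c :* a) :* (b :* d)) refl a b c′ d)

  ⊗-identityˡ : ∀ x → 𝟙 ⊗ x ≃ x
  ⊗-identityˡ ((a , b) , _) = ≈⇒≡𝔭 (solve 2 (λ a b → (con 1 :* a) :* b := a :* (con 1 :* b)) refl a b)

  ⊗-identityʳ : ∀ x → x ⊗ 𝟙 ≃ x
  ⊗-identityʳ ((a , b) , _) = ≈⇒≡𝔭 (solve 2 (λ a b → (a :* con 1) :* b := a :* (b :* con 1)) refl a b)

  ⊗-distribˡ : ∀ x y z → x ⊗ (y ⊕ z) ≃ (x ⊗ y) ⊕ (x ⊗ z)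
  ⊗-distribˡ ((a , b) , _) ((c′ , d) , _) ((e , f) , _) = ≈⇒≡𝔭
    (solve 6 (λ a b c d e f → (a :* (c :* f :+ e :* d)) :* ((b :* d) :* (b :* f))
                            := ((a :* c) :* (b :* f) :+ (a :* e) :* (b :* d)) :* (b :* (d :* f)))
           refl a b c′ d e f)

  ⊗-distribʳ : ∀ x y z → (y ⊕ z) ⊗ x ≃ (y ⊗ x) ⊕ (z ⊗ x)
  ⊗-distribʳ ((a , b) , _) ((c′ , d) , _) ((e , f) , _) = ≈⇒≡𝔭
    (solve 6 (λ a b c d e f → ((c :* f :+ e :* d) :* a) :* ((d :* b) :* (f :* b))
                            := ((c :* a) :* (f :* b) :+ (e :* a) :* (d :* b)) :* ((d :* f) :* b))
           refl a b c′ d e f)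

  κ : CommutativeRing (c ⊔ i) i
  κ = record
    { Carrier = Fraction ; _≈_ = _≃_ ; _+_ = _⊕_ ; _*_ = _⊗_ ; -_ = ⊖_ ; 0# = 𝟘 ; 1# = 𝟙
    ; isCommutativeRing = record
      { isRing = record
        { +-isAbelianGroup = record
          { isGroup = record
            { isMonoid = record
              { isSemigroup = record
                { isMagma = record
                  { isEquivalence = record
                    { refl  = λ {x} → ≃-refl {x}
                    ; sym   = λ {x} {y} → ≃-sym {x} {y}
                    ; trans = λ {x} {y} {z} → ≃-trans {x} {y} {z} }
                  ; ∙-cong = λ {x} {x′} {y} {y′} → ⊕-cong {x} {x′} {y} {y′} }
                ; assoc = ⊕-assoc }
              ; identity = ⊕-identityˡ , ⊕-identityʳ }
            ; inverse = ⊕-inverseˡ , ⊕-inverseʳ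
            ; ⁻¹-cong = λ {x} {x′} → ⊖-cong {x} {x′} }
          ; comm = ⊕-comm }
        ; *-cong = λ {x} {x′} {y} {y′} → ⊗-cong {x} {x′} {y} {y′}
        ; *-assoc = ⊗-assoc
        ; *-identity = ⊗-identityˡ , ⊗-identityʳ
        ; distrib = ⊗-distribˡ , ⊗-distribʳ }
      ; *-comm = ⊗-comm } }

chains-bounded : ∀ {c ℓ} (F : FiniteField c ℓ) h r → All (All (_< h)) (FF.chains F h r)
chains-bounded F h zero    = [] ∷ []
chains-bounded F h (suc r) =
  All.concat⁺ (All.map⁺ (All.map (λ {d} d<h → All.map⁺ (All.map (λ {ds} ds<d →
    d<h ∷ All.map (λ e<d → ℕ.<-trans e<d d<h) ds<d) (chains-bounded F d r))) (All.all-upTo h)))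

module ChainSum {c ℓ} (F : FiniteField c ℓ) {r ℓr} (R : RawRing r ℓr) (g : ℕ → ℤ → RawRing.Carrier R)
  where
  open RawRing R
  open RawSum R
  open FF F using (chains; splitCond)

  term : List ℤ → List ℕ → Carrier
  term s ds = foldr _*_ 1# (zipWith g ds s)

  ζ< : List ℤ → ℕ → Carrier
  ζ< s h = ∑ (chains h (length s)) (term s)

  splitSum : List ℤ → ℕ → ℕ → ℕ → Carrier
  splitSum s M N h = ∑ (filterᵇ (splitCond M N) (chains h (length s))) (term s)

  linearCombination : List (Carrier × List ℤ) → ℕ → Carrier
  linearCombination L h = ∑ L (λ (a , u) → a * ζ< u h)

  combination : ℕ → List ℤ → List (Carrier × List ℤ)
  combination N []      = [ 1# , [] ]
  combination N (t ∷ u) = let shifted = map (map₂ (t ∷_)) (combination N u) in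
    shifted ++ [ - linearCombination shifted N , [] ]

  splitCombination : List ℤ → ℕ → ℕ → List (Carrier × List ℤ)
  splitCombination s M N = map (map₁ (_* ζ< (drop M s) N)) (combination N (take M s))

  combination-depth : ∀ N t → All (λ (_ , u) → length u ≤ length t) (combination N t)
  combination-depth N []      = z≤n ∷ []
  combination-depth N (t ∷ u) = All.++⁺ (All.map⁺ (All.map s≤s (combination-depth N u))) (z≤n ∷ [])

record StrictHomomorphism {a ℓa b ℓb} (A : RawRing a ℓa) (B : RawRing b ℓb) : Set (a ⊔ b) where
  private
    module A = RawRing A
    module B = RawRing B
  field
    ⟦_⟧ : A.Carrier → B.Carrier
    ⟦+⟧ : ∀ x y → ⟦ x A.+ y ⟧ ≡ ⟦ x ⟧ B.+ ⟦ y ⟧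
    ⟦*⟧ : ∀ x y → ⟦ x A.* y ⟧ ≡ ⟦ x ⟧ B.* ⟦ y ⟧
    ⟦-⟧ : ∀ x → ⟦ A.- x ⟧ ≡ B.- ⟦ x ⟧
    ⟦0⟧ : ⟦ A.0# ⟧ ≡ B.0#
    ⟦1⟧ : ⟦ A.1# ⟧ ≡ B.1#

module ChainSumMap {c ℓ} (F : FiniteField c ℓ) {a ℓa b ℓb} {A : RawRing a ℓa} {B : RawRing b ℓb}
  (φ : StrictHomomorphism A B) (gA : ℕ → ℤ → RawRing.Carrier A) (gB : ℕ → ℤ → RawRing.Carrier B)
  (H : ℕ) (⟦g⟧ : ∀ d s → d < H → StrictHomomorphism.⟦_⟧ φ (gA d s) ≡ gB d s) where
  open StrictHomomorphism φ
  open FF F using (chains; splitCond)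
  private
    module A = RawRing A
    module B = RawRing B
    module ΣA = RawSum A
    module ΣB = RawSum B
    module CA = ChainSum F A gA
    module CB = ChainSum F B gB
  open ≡.≡-Reasoning

  ⟦∑⟧ : (l : List X) (f : X → A.Carrier) (f′ : X → B.Carrier) →
        All (λ x → ⟦ f x ⟧ ≡ f′ x) l → ⟦ ΣA.∑ l f ⟧ ≡ ΣB.∑ l f′
  ⟦∑⟧ []      f f′ []         = ⟦0⟧
  ⟦∑⟧ (x ∷ l) f f′ (fx ∷ fl) = ≡.trans (⟦+⟧ _ _) (≡.cong₂ B._+_ fx (⟦∑⟧ l f f′ fl))

  ⟦term⟧ : ∀ s ds → All (_< H) ds → ⟦ CA.term s ds ⟧ ≡ CB.term s ds
  ⟦term⟧ []      []       _            = ⟦1⟧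
  ⟦term⟧ []      (d ∷ ds) _            = ⟦1⟧
  ⟦term⟧ (t ∷ s) []       _            = ⟦1⟧
  ⟦term⟧ (t ∷ s) (d ∷ ds) (d<H ∷ ds<H) = ≡.trans (⟦*⟧ _ _) (≡.cong₂ B._*_ (⟦g⟧ d t d<H) (⟦term⟧ s ds ds<H))

  ⟦term⟧-chains : ∀ s h r → h ≤ H → All (λ ds → ⟦ CA.term s ds ⟧ ≡ CB.term s ds) (chains h r)
  ⟦term⟧-chains s h r h≤H =
    All.map (λ {ds} ds<h → ⟦term⟧ s ds (All.map (λ d<h → ℕ.<-≤-trans d<h h≤H) ds<h)) (chains-bounded F h r)

  ⟦ζ<⟧ : ∀ s h → h ≤ H → ⟦ CA.ζ< s h ⟧ ≡ CB.ζ< s h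
  ⟦ζ<⟧ s h h≤H = ⟦∑⟧ _ (CA.term s) (CB.term s) (⟦term⟧-chains s h (length s) h≤H)

  ⟦splitSum⟧ : ∀ s M N h → h ≤ H → ⟦ CA.splitSum s M N h ⟧ ≡ CB.splitSum s M N h
  ⟦splitSum⟧ s M N h h≤H =
    ⟦∑⟧ _ (CA.term s) (CB.term s) (All.filter⁺ _ (⟦term⟧-chains s h (length s) h≤H))

  ⟦linearCombination⟧ : ∀ L h → h ≤ H → ⟦ CA.linearCombination L h ⟧ ≡ CB.linearCombination (map (map₁ ⟦_⟧) L) h
  ⟦linearCombination⟧ L h h≤H = begin
    ⟦ CA.linearCombination L h ⟧
      ≡⟨ ⟦∑⟧ L _ _ (All.universal (λ (a , u) → ≡.trans (⟦*⟧ _ _) (≡.cong (⟦ a ⟧ B.*_) (⟦ζ<⟧ u h h≤H))) L) ⟩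
    ΣB.∑ L (λ (a , u) → ⟦ a ⟧ B.* CB.ζ< u h)
      ≡⟨ ≡.cong (foldr B._+_ B.0#) (List.map-∘ L) ⟩
    CB.linearCombination (map (map₁ ⟦_⟧) L) h ∎

  ⟦combination⟧ : ∀ N t → N ≤ H → map (map₁ ⟦_⟧) (CA.combination N t) ≡ CB.combination N t
  ⟦combination⟧ N []      N≤H = ≡.cong (λ z → [ z , [] ]) ⟦1⟧
  ⟦combination⟧ N (t ∷ u) N≤H = begin
    map (map₁ ⟦_⟧) (shifted ++ [ A.- CA.linearCombination shifted N , [] ])
      ≡⟨ List.map-++ (map₁ ⟦_⟧) shifted _ ⟩
    map (map₁ ⟦_⟧) shifted ++ [ ⟦ A.- CA.linearCombination shifted N ⟧ , [] ]
      ≡⟨ ≡.cong₂ (λ l z → l ++ [ z , [] ]) ⟦shifted⟧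
                 (≡.trans (⟦-⟧ _) (≡.cong B.-_ (⟦linearCombination⟧ shifted N N≤H))) ⟩
    map (map₂ (t ∷_)) (CB.combination N u) ++
      [ B.- CB.linearCombination (map (map₁ ⟦_⟧) shifted) N , [] ]
      ≡⟨ ≡.cong (λ l → map (map₂ (t ∷_)) (CB.combination N u) ++ [ B.- CB.linearCombination l N , [] ])
                ⟦shifted⟧ ⟩
    CB.combination N (t ∷ u) ∎
    where
    shifted = map (map₂ (t ∷_)) (CA.combination N u)
    ⟦shifted⟧ : map (map₁ ⟦_⟧) shifted ≡ map (map₂ (t ∷_)) (CB.combination N u)
    ⟦shifted⟧ = begin
      map (map₁ ⟦_⟧) shifted                              ≡⟨ ≡.sym (List.map-∘ (CA.combination N u)) ⟩
      map (map₂ (t ∷_) ∘ map₁ ⟦_⟧) (CA.combination N u)   ≡⟨ List.map-∘ (CA.combination N u) ⟩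
      map (map₂ (t ∷_)) (map (map₁ ⟦_⟧) (CA.combination N u))
        ≡⟨ ≡.cong (map (map₂ (t ∷_))) (⟦combination⟧ N u N≤H) ⟩
      map (map₂ (t ∷_)) (CB.combination N u) ∎

  ⟦splitCombination⟧ : ∀ s M N → N ≤ H → map (map₁ ⟦_⟧) (CA.splitCombination s M N) ≡ CB.splitCombination s M N
  ⟦splitCombination⟧ s M N N≤H = begin
    map (map₁ ⟦_⟧) (map (map₁ (A._* z)) L)         ≡⟨ ≡.sym (List.map-∘ L) ⟩
    map (map₁ (λ a → ⟦ a A.* z ⟧)) L               ≡⟨ List.map-cong (λ (a , _) → ≡.cong (_, _) (⟦a*z⟧ a)) L ⟩
    map (map₁ (B._* CB.ζ< (drop M s) N) ∘ map₁ ⟦_⟧) L ≡⟨ List.map-∘ L ⟩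
    map (map₁ (B._* CB.ζ< (drop M s) N)) (map (map₁ ⟦_⟧) L)
      ≡⟨ ≡.cong (map (map₁ (B._* CB.ζ< (drop M s) N))) (⟦combination⟧ N (take M s) N≤H) ⟩
    CB.splitCombination s M N ∎
    where
    L = CA.combination N (take M s)
    z = CA.ζ< (drop M s) N
    ⟦a*z⟧ : ∀ a → ⟦ a A.* z ⟧ ≡ ⟦ a ⟧ B.* CB.ζ< (drop M s) N
    ⟦a*z⟧ a = ≡.trans (⟦*⟧ a z) (≡.cong (⟦ a ⟧ B.*_) (⟦ζ<⟧ (drop M s) N N≤H))

module ChainSumIdentity {c ℓ} (F : FiniteField c ℓ) {r ℓr} (R : CommutativeRing r ℓr)
  (g : ℕ → ℤ → CommutativeRing.Carrier R) where
  open CommutativeRing R hiding (zero)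
  open SumProperties R
  open ChainSum F rawRing g
  open FF F using (chains; splitCond; allᵇ)
  open import Algebra.Properties.Ring ring using (x[y-z]≈xy-xz)
  open import Algebra.Solver.Ring.NaturalCoefficients.Default commutativeSemiring
  open import Relation.Binary.Reasoning.Setoid setoid

  ∑-chains-suc : ∀ h r (f : List ℕ → Carrier) →
                 ∑ (chains h (suc r)) f ≈ ∑< h (λ d → ∑ (chains d r) (f ∘ (d ∷_)))
  ∑-chains-suc h r f = trans (∑-concatMap (λ d → map (d ∷_) (chains d r)) (upTo h) f)
                             (∑-cong (upTo h) (λ d → ∑-map (d ∷_) (chains d r) f))

  ζ<-∷ : ∀ t s h → ζ< (t ∷ s) h ≈ ∑< h (λ d → g d t * ζ< s d)
  ζ<-∷ t s h = trans (∑-chains-suc h (length s) (term (t ∷ s)))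
                     (∑-cong (upTo h) (λ d → ∑-*ˡ (chains d (length s)) (g d t) (term s)))

  module _ (N : ℕ) where

    ∑-chains-below : ∀ r d → d ≤ N → (f : List ℕ → Carrier) →
                     ∑ (chains d r) (λ ds → when (allᵇ (_<ᵇ N) ds) (f ds)) ≈ ∑ (chains d r) f
    ∑-chains-below zero    d d≤N f = refl
    ∑-chains-below (suc r) d d≤N f = begin
      ∑ (chains d (suc r)) (λ ds → when (allᵇ (_<ᵇ N) ds) (f ds))
        ≈⟨ ∑-chains-suc d r _ ⟩
      ∑< d (λ e → ∑ (chains e r) (λ ds → when ((e <ᵇ N) ∧ allᵇ (_<ᵇ N) ds) (f (e ∷ ds))))
        ≈⟨ ∑<-cong d (λ e e<d → below e (ℕ.<-≤-trans e<d d≤N)) ⟩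
      ∑< d (λ e → ∑ (chains e r) (f ∘ (e ∷_)))
        ≈⟨ sym (∑-chains-suc d r f) ⟩
      ∑ (chains d (suc r)) f ∎
      where
      below : ∀ e → e < N → ∑ (chains e r) (λ ds → when ((e <ᵇ N) ∧ allᵇ (_<ᵇ N) ds) (f (e ∷ ds)))
                          ≈ ∑ (chains e r) (f ∘ (e ∷_))
      below e e<N with e <ᵇ N | ℕ.<⇒<ᵇ e<N
      ... | true | _ = ∑-chains-below r e (ℕ.<⇒≤ e<N) (f ∘ (e ∷_))

    ζ<-below : ∀ s h → N ≤ h → ∑ (chains h (length s)) (λ ds → when (allᵇ (_<ᵇ N) ds) (term s ds)) ≈ ζ< s N
    ζ<-below []      h N≤h = refl
    ζ<-below (t ∷ s) h N≤h = begin
      ∑ (chains h (suc (length s))) (λ ds → when (allᵇ (_<ᵇ N) ds) (term (t ∷ s) ds))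
        ≈⟨ ∑-chains-suc h (length s) _ ⟩
      ∑< h (λ d → ∑ (chains d (length s)) (λ ds → when ((d <ᵇ N) ∧ allᵇ (_<ᵇ N) ds) (g d t * term s ds)))
        ≈⟨ ∑-cong (upTo h) head ⟩
      ∑< h (λ d → when (d <ᵇ N) (g d t * ζ< s d))
        ≈⟨ ∑<-below N h _ N≤h ⟩
      ∑< N (λ d → g d t * ζ< s d)
        ≈⟨ sym (ζ<-∷ t s N) ⟩
      ζ< (t ∷ s) N ∎
      where
      head : ∀ d → ∑ (chains d (length s)) (λ ds → when ((d <ᵇ N) ∧ allᵇ (_<ᵇ N) ds) (g d t * term s ds))
                 ≈ when (d <ᵇ N) (g d t * ζ< s d)
      head d with d <ᵇ N in d<ᵇN
      ... | false = ∑-zero (chains d (length s))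
      ... | true  = trans (∑-chains-below (length s) d d≤N _) (∑-*ˡ (chains d (length s)) (g d t) (term s))
        where d≤N = ℕ.<⇒≤ (ℕ.<ᵇ⇒< d N (≡.subst T (≡.sym d<ᵇN) tt))

    ζ≥ : List ℤ → ℕ → Carrier
    ζ≥ []      h = 1#
    ζ≥ (t ∷ u) h = ∑< h (λ d → when (N ≤ᵇ d) (g d t * ζ≥ u d))

    when-∧-*ˡ : ∀ a b c u v → when ((a ∧ b) ∧ c) (u * v) ≈ when a (u * when (b ∧ c) v)
    when-∧-*ˡ true  b c u v = when-*ˡ (b ∧ c) u v
    when-∧-*ˡ false b c u v = refl

    splitSum-factorises : ∀ M s h → N ≤ h → splitSum s M N h ≈ ζ≥ (take M s) h * ζ< (drop M s) N
    splitSum-factorises zero    []      h N≤h = sym (*-identityˡ _)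
    splitSum-factorises (suc M) []      h N≤h = sym (*-identityˡ _)
    splitSum-factorises zero    (t ∷ s) h N≤h = begin
      splitSum (t ∷ s) zero N h     ≈⟨ ∑-filterᵇ (splitCond zero N) (chains h (suc (length s))) _ ⟩
      _                             ≈⟨ ζ<-below (t ∷ s) h N≤h ⟩
      ζ< (t ∷ s) N                  ≈⟨ sym (*-identityˡ _) ⟩
      1# * ζ< (t ∷ s) N             ∎
    splitSum-factorises (suc M) (t ∷ s) h N≤h = begin
      splitSum (t ∷ s) (suc M) N h
        ≈⟨ ∑-filterᵇ (splitCond (suc M) N) (chains h (suc (length s))) _ ⟩
      ∑ (chains h (suc (length s))) (λ ds → when (splitCond (suc M) N ds) (term (t ∷ s) ds))
        ≈⟨ ∑-chains-suc h (length s) _ ⟩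
      ∑< h (λ d → ∑ (chains d (length s)) (λ ds → when (splitCond (suc M) N (d ∷ ds)) (g d t * term s ds)))
        ≈⟨ ∑-cong (upTo h) (λ d → ∑-cong (chains d (length s)) (λ ds → when-∧-*ˡ (N ≤ᵇ d) _ _ (g d t) (term s ds))) ⟩
      ∑< h (λ d → ∑ (chains d (length s)) (λ ds → when (N ≤ᵇ d) (g d t * when (splitCond M N ds) (term s ds))))
        ≈⟨ ∑-cong (upTo h) (λ d → trans (∑-when (chains d (length s)) (N ≤ᵇ d) _) (when-cong (N ≤ᵇ d) (inner d))) ⟩
      ∑< h (λ d → when (N ≤ᵇ d) (g d t * splitSum s M N d))
        ≈⟨ ∑-cong (upTo h) first ⟩
      ∑< h (λ d → when (N ≤ᵇ d) (g d t * ζ≥ (take M s) d) * ζ< (drop M s) N)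
        ≈⟨ ∑-*ʳ (upTo h) _ _ ⟩
      ζ≥ (t ∷ take M s) h * ζ< (drop M s) N ∎
      where
      inner : ∀ d → ∑ (chains d (length s)) (λ ds → g d t * when (splitCond M N ds) (term s ds))
                  ≈ g d t * splitSum s M N d
      inner d = trans (∑-*ˡ (chains d (length s)) (g d t) _)
                      (*-cong refl (sym (∑-filterᵇ (splitCond M N) (chains d (length s)) (term s))))
      first : ∀ d → when (N ≤ᵇ d) (g d t * splitSum s M N d)
                  ≈ when (N ≤ᵇ d) (g d t * ζ≥ (take M s) d) * ζ< (drop M s) N
      first d with N ≤ᵇ d in N≤ᵇd
      ... | false = sym (zeroˡ _)
      ... | true  = trans (*-cong refl (splitSum-factorises M s d N≤d)) (sym (*-assoc _ _ _))
        where N≤d = ℕ.≤ᵇ⇒≤ N d (≡.subst T (≡.sym N≤ᵇd) tt)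

    ∑<-ζ<-above : ∀ t v h → N ≤ h → ∑< h (λ d → when (N ≤ᵇ d) (g d t * ζ< v d)) ≈ ζ< (t ∷ v) h - ζ< (t ∷ v) N
    ∑<-ζ<-above t v h N≤h = trans (∑<-above N h _ N≤h) (+-cong (sym (ζ<-∷ t v h)) (-‿cong (sym (ζ<-∷ t v N))))

    ζ≥-combination : ∀ t h → N ≤ h → ζ≥ t h ≈ linearCombination (combination N t) h
    ζ≥-combination []      h N≤h = sym (trans (+-identityʳ _) (trans (*-identityˡ _) (+-identityʳ 1#)))
    ζ≥-combination (t ∷ u) h N≤h = begin
      ∑< h (λ d → when (N ≤ᵇ d) (g d t * ζ≥ u d))
        ≈⟨ ∑-cong (upTo h) expand ⟩
      ∑< h (λ d → ∑ L (λ (a , v) → a * when (N ≤ᵇ d) (g d t * ζ< v d)))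
        ≈⟨ ∑-swap (upTo h) L _ ⟩
      ∑ L (λ (a , v) → ∑< h (λ d → a * when (N ≤ᵇ d) (g d t * ζ< v d)))
        ≈⟨ ∑-cong L (λ (a , v) → trans (∑-*ˡ (upTo h) a _) (*-cong refl (∑<-ζ<-above t v h N≤h))) ⟩
      ∑ L (λ (a , v) → a * (ζ< (t ∷ v) h - ζ< (t ∷ v) N))
        ≈⟨ ∑-cong L (λ (a , v) → x[y-z]≈xy-xz a _ _) ⟩
      ∑ L (λ (a , v) → a * ζ< (t ∷ v) h - a * ζ< (t ∷ v) N)
        ≈⟨ trans (∑-+ L _ _) (+-cong refl (∑-neg L _)) ⟩
      ∑ L (λ (a , v) → a * ζ< (t ∷ v) h) - ∑ L (λ (a , v) → a * ζ< (t ∷ v) N)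
        ≈⟨ sym (+-cong (∑-map (map₂ (t ∷_)) L _) (-‿cong (∑-map (map₂ (t ∷_)) L _))) ⟩
      linearCombination shifted h - linearCombination shifted N
        ≈⟨ +-cong refl (sym (trans (+-identityʳ _) (trans (*-cong refl (+-identityʳ 1#)) (*-identityʳ _)))) ⟩
      linearCombination shifted h + linearCombination [ - linearCombination shifted N , [] ] h
        ≈⟨ sym (∑-++ shifted _ _) ⟩
      linearCombination (combination N (t ∷ u)) h ∎
      where
      L = combination N u
      shifted = map (map₂ (t ∷_)) L
      expand : ∀ d → when (N ≤ᵇ d) (g d t * ζ≥ u d) ≈ ∑ L (λ (a , v) → a * when (N ≤ᵇ d) (g d t * ζ< v d))
      expand d with N ≤ᵇ d in N≤ᵇd
      ... | false = sym (trans (∑-cong L (λ _ → zeroʳ _)) (∑-zero L))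
      ... | true  = begin
        g d t * ζ≥ u d                            ≈⟨ *-cong refl (ζ≥-combination u d N≤d) ⟩
        g d t * ∑ L (λ (a , v) → a * ζ< v d)      ≈⟨ sym (∑-*ˡ L (g d t) _) ⟩
        ∑ L (λ (a , v) → g d t * (a * ζ< v d))
          ≈⟨ ∑-cong L (λ (a , v) → solve 3 (λ x y z → x :* (y :* z) := y :* (x :* z)) refl (g d t) a (ζ< v d)) ⟩
        ∑ L (λ (a , v) → a * (g d t * ζ< v d))    ∎
        where N≤d = ℕ.≤ᵇ⇒≤ N d (≡.subst T (≡.sym N≤ᵇd) tt)

    splitSum-combination : ∀ s M h → N ≤ h → splitSum s M N h ≈ linearCombination (splitCombination s M N) h
    splitSum-combination s M h N≤h = begin
      splitSum s M N h
        ≈⟨ splitSum-factorises M s h N≤h ⟩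
      ζ≥ (take M s) h * z
        ≈⟨ *-cong (ζ≥-combination (take M s) h N≤h) refl ⟩
      ∑ L (λ (a , u) → a * ζ< u h) * z
        ≈⟨ sym (∑-*ʳ L z _) ⟩
      ∑ L (λ (a , u) → a * ζ< u h * z)
        ≈⟨ ∑-cong L (λ (a , u) → solve 3 (λ a x z → a :* x :* z := a :* z :* x) refl a (ζ< u h) z) ⟩
      ∑ L (λ (a , u) → a * z * ζ< u h)
        ≈⟨ sym (∑-map (map₁ (_* z)) L _) ⟩
      linearCombination (splitCombination s M N) h ∎
      where
      L = combination N (take M s)
      z = ζ< (drop M s) N

module Polynomials {c ℓ} (F : FiniteField c ℓ) where
  open FiniteField F hiding (zero)
  open FF F
  open import Algebra.Properties.Group +-group using (ε⁻¹≈ε)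
  open import Algebra.Solver.Ring.NaturalCoefficients.Default commutativeSemiring
  open import Relation.Binary.Reasoning.Setoid setoid

  -- A record rather than _≈ₚ_ itself, so that both polynomials can be inferred from a proof.
  infix 4 _≋_
  record _≋_ (f g : Poly) : Set ℓ where
    constructor mk
    field get : f ≈ₚ g
  open _≋_ public

  ≋-refl : ∀ {f} → f ≋ f
  ≋-refl = mk λ n → refl

  ≋-sym : ∀ {f g} → f ≋ g → g ≋ f
  ≋-sym (mk f≈g) = mk λ n → sym (f≈g n)

  ≋-trans : ∀ {f g h} → f ≋ g → g ≋ h → f ≋ h
  ≋-trans (mk f≈g) (mk g≈h) = mk λ n → trans (f≈g n) (g≈h n)

  ∷-cong : ∀ {a b f g} → a ≈ b → f ≋ g → a ∷ f ≋ b ∷ g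
  ∷-cong a≈b (mk f≈g) = mk λ { zero → a≈b ; (suc n) → f≈g n }

  ∷-injectiveˡ : ∀ {a b f g} → a ∷ f ≋ b ∷ g → a ≈ b
  ∷-injectiveˡ (mk p) = p zero

  ∷-injectiveʳ : ∀ {a b f g} → a ∷ f ≋ b ∷ g → f ≋ g
  ∷-injectiveʳ (mk p) = mk λ n → p (suc n)

  ∷≋[] : ∀ {a f} → a ≈ 0# → f ≋ [] → a ∷ f ≋ []
  ∷≋[] a≈0 (mk f≈[]) = mk λ { zero → a≈0 ; (suc n) → f≈[] n }

  ∷≋[]⇒head≈0 : ∀ {a f} → a ∷ f ≋ [] → a ≈ 0#
  ∷≋[]⇒head≈0 (mk p) = p zero

  ∷≋[]⇒tail≋[] : ∀ {a f} → a ∷ f ≋ [] → f ≋ []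
  ∷≋[]⇒tail≋[] (mk p) = mk λ n → p (suc n)

  coeff-+ : ∀ f g n → coeff (f +ₚ g) n ≈ coeff f n + coeff g n
  coeff-+ []      g       n       = sym (+-identityˡ _)
  coeff-+ (a ∷ f) []      n       = sym (+-identityʳ _)
  coeff-+ (a ∷ f) (b ∷ g) zero    = refl
  coeff-+ (a ∷ f) (b ∷ g) (suc n) = coeff-+ f g n

  coeff-neg : ∀ f n → coeff (negₚ f) n ≈ - coeff f n
  coeff-neg []      n       = sym ε⁻¹≈ε
  coeff-neg (a ∷ f) zero    = refl
  coeff-neg (a ∷ f) (suc n) = coeff-neg f n

  coeff-scale : ∀ a f n → coeff (scale a f) n ≈ a * coeff f n
  coeff-scale a []      n       = sym (zeroʳ a)
  coeff-scale a (b ∷ f) zero    = refl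
  coeff-scale a (b ∷ f) (suc n) = coeff-scale a f n

  coeff-[0] : ∀ n → coeff (0# ∷ []) n ≈ 0#
  coeff-[0] zero    = refl
  coeff-[0] (suc n) = refl

  coeff-0∷-+ : ∀ {f g h} → (∀ n → coeff f n ≈ coeff g n + coeff h n) →
               ∀ n → coeff (0# ∷ f) n ≈ coeff (0# ∷ g) n + coeff (0# ∷ h) n
  coeff-0∷-+ p zero    = sym (+-identityʳ 0#)
  coeff-0∷-+ p (suc n) = p n

  coeff-0∷-scale : ∀ a f n → coeff (0# ∷ scale a f) n ≈ a * coeff (0# ∷ f) n
  coeff-0∷-scale a f zero    = sym (zeroʳ a)
  coeff-0∷-scale a f (suc n) = coeff-scale a f n

  coeff-∷-*ₚ : ∀ a f g n → coeff ((a ∷ f) *ₚ g) n ≈ a * coeff g n + coeff (0# ∷ (f *ₚ g)) n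
  coeff-∷-*ₚ a f g n = trans (coeff-+ (scale a g) (0# ∷ (f *ₚ g)) n) (+-cong (coeff-scale a g n) refl)

  +ₚ-cong : ∀ {f f′ g g′} → f ≋ f′ → g ≋ g′ → f +ₚ g ≋ f′ +ₚ g′
  +ₚ-cong {f} {f′} {g} {g′} (mk p) (mk q) =
    mk λ n → trans (coeff-+ f g n) (trans (+-cong (p n) (q n)) (sym (coeff-+ f′ g′ n)))

  negₚ-cong : ∀ {f f′} → f ≋ f′ → negₚ f ≋ negₚ f′
  negₚ-cong {f} {f′} (mk p) = mk λ n → trans (coeff-neg f n) (trans (-‿cong (p n)) (sym (coeff-neg f′ n)))

  scale-cong : ∀ {a b f g} → a ≈ b → f ≋ g → scale a f ≋ scale b g
  scale-cong {a} {b} {f} {g} a≈b (mk q) =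
    mk λ n → trans (coeff-scale a f n) (trans (*-cong a≈b (q n)) (sym (coeff-scale b g n)))

  +ₚ-comm : ∀ f g → f +ₚ g ≋ g +ₚ f
  +ₚ-comm f g = mk λ n → trans (coeff-+ f g n) (trans (+-comm _ _) (sym (coeff-+ g f n)))

  +ₚ-assoc : ∀ f g h → (f +ₚ g) +ₚ h ≋ f +ₚ (g +ₚ h)
  +ₚ-assoc f g h = mk λ n → begin
    coeff ((f +ₚ g) +ₚ h) n                  ≈⟨ trans (coeff-+ (f +ₚ g) h n) (+-cong (coeff-+ f g n) refl) ⟩
    (coeff f n + coeff g n) + coeff h n      ≈⟨ +-assoc _ _ _ ⟩
    coeff f n + (coeff g n + coeff h n)      ≈⟨ sym (trans (coeff-+ f (g +ₚ h) n) (+-cong refl (coeff-+ g h n))) ⟩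
    coeff (f +ₚ (g +ₚ h)) n                  ∎

  +ₚ-identityʳ : ∀ f → f +ₚ [] ≋ f
  +ₚ-identityʳ f = mk λ n → trans (coeff-+ f [] n) (+-identityʳ _)

  +ₚ-inverseʳ : ∀ f → f +ₚ negₚ f ≋ []
  +ₚ-inverseʳ f = mk λ n → trans (coeff-+ f (negₚ f) n) (trans (+-cong refl (coeff-neg f n)) (-‿inverseʳ _))

  +ₚ-inverseˡ : ∀ f → negₚ f +ₚ f ≋ []
  +ₚ-inverseˡ f = ≋-trans (+ₚ-comm (negₚ f) f) (+ₚ-inverseʳ f)

  ≋[]⇒*ₚ≋[] : ∀ f g → f ≋ [] → f *ₚ g ≋ []
  ≋[]⇒*ₚ≋[] []      g f≋[] = ≋-refl
  ≋[]⇒*ₚ≋[] (a ∷ f) g f≋[] = mk λ n → begin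
    coeff ((a ∷ f) *ₚ g) n                     ≈⟨ coeff-∷-*ₚ a f g n ⟩
    a * coeff g n + coeff (0# ∷ (f *ₚ g)) n    ≈⟨ +-cong (trans (*-cong (∷≋[]⇒head≈0 f≋[]) refl) (zeroˡ _)) (tail n) ⟩
    0# + 0#                                     ≈⟨ +-identityʳ 0# ⟩
    0#                                          ∎
    where
    tail : ∀ n → coeff (0# ∷ (f *ₚ g)) n ≈ 0#
    tail zero    = refl
    tail (suc n) = get (≋[]⇒*ₚ≋[] f g (∷≋[]⇒tail≋[] f≋[])) n

  *ₚ-congˡ : ∀ f f′ g → f ≋ f′ → f *ₚ g ≋ f′ *ₚ g
  *ₚ-congˡ []      f′        g f≋f′ = ≋-sym (≋[]⇒*ₚ≋[] f′ g (≋-sym f≋f′))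
  *ₚ-congˡ (a ∷ f) []        g f≋f′ = ≋[]⇒*ₚ≋[] (a ∷ f) g f≋f′
  *ₚ-congˡ (a ∷ f) (a′ ∷ f′) g f≋f′ =
    +ₚ-cong (scale-cong {f = g} (∷-injectiveˡ f≋f′) ≋-refl) (∷-cong refl (*ₚ-congˡ f f′ g (∷-injectiveʳ f≋f′)))

  *ₚ-congʳ : ∀ f g g′ → g ≋ g′ → f *ₚ g ≋ f *ₚ g′
  *ₚ-congʳ []      g g′ g≋g′ = ≋-refl
  *ₚ-congʳ (a ∷ f) g g′ g≋g′ = +ₚ-cong (scale-cong refl g≋g′) (∷-cong refl (*ₚ-congʳ f g g′ g≋g′))

  *ₚ-cong : ∀ {f f′ g g′} → f ≋ f′ → g ≋ g′ → f *ₚ g ≋ f′ *ₚ g′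
  *ₚ-cong {f} {f′} {g} {g′} f≋f′ g≋g′ = ≋-trans (*ₚ-congˡ f f′ g f≋f′) (*ₚ-congʳ f′ g g′ g≋g′)

  *ₚ-distribʳ : ∀ g f h → (f +ₚ h) *ₚ g ≋ (f *ₚ g) +ₚ (h *ₚ g)
  *ₚ-distribʳ g []      h       = ≋-refl
  *ₚ-distribʳ g (a ∷ f) []      = ≋-sym (+ₚ-identityʳ _)
  *ₚ-distribʳ g (a ∷ f) (b ∷ h) = mk λ n → begin
    coeff (((a ∷ f) +ₚ (b ∷ h)) *ₚ g) n
      ≈⟨ coeff-∷-*ₚ (a + b) (f +ₚ h) g n ⟩
    (a + b) * coeff g n + coeff (0# ∷ ((f +ₚ h) *ₚ g)) n
      ≈⟨ +-cong refl (coeff-0∷-+ (λ m → trans (get (*ₚ-distribʳ g f h) m) (coeff-+ (f *ₚ g) (h *ₚ g) m)) n) ⟩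
    (a + b) * coeff g n + (coeff (0# ∷ (f *ₚ g)) n + coeff (0# ∷ (h *ₚ g)) n)
      ≈⟨ solve 5 (λ a b x y z → (a :+ b) :* x :+ (y :+ z) := (a :* x :+ y) :+ (b :* x :+ z))
               refl a b (coeff g n) _ _ ⟩
    (a * coeff g n + coeff (0# ∷ (f *ₚ g)) n) + (b * coeff g n + coeff (0# ∷ (h *ₚ g)) n)
      ≈⟨ sym (+-cong (coeff-∷-*ₚ a f g n) (coeff-∷-*ₚ b h g n)) ⟩
    coeff ((a ∷ f) *ₚ g) n + coeff ((b ∷ h) *ₚ g) n
      ≈⟨ sym (coeff-+ ((a ∷ f) *ₚ g) ((b ∷ h) *ₚ g) n) ⟩
    coeff (((a ∷ f) *ₚ g) +ₚ ((b ∷ h) *ₚ g)) n ∎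

  *ₚ-distribˡ : ∀ f g h → f *ₚ (g +ₚ h) ≋ (f *ₚ g) +ₚ (f *ₚ h)
  *ₚ-distribˡ []      g h = ≋-refl
  *ₚ-distribˡ (a ∷ f) g h = mk λ n → begin
    coeff ((a ∷ f) *ₚ (g +ₚ h)) n
      ≈⟨ coeff-∷-*ₚ a f (g +ₚ h) n ⟩
    a * coeff (g +ₚ h) n + coeff (0# ∷ (f *ₚ (g +ₚ h))) n
      ≈⟨ +-cong (*-cong refl (coeff-+ g h n))
                (coeff-0∷-+ (λ m → trans (get (*ₚ-distribˡ f g h) m) (coeff-+ (f *ₚ g) (f *ₚ h) m)) n) ⟩
    a * (coeff g n + coeff h n) + (coeff (0# ∷ (f *ₚ g)) n + coeff (0# ∷ (f *ₚ h)) n)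
      ≈⟨ solve 5 (λ a x y z w → a :* (x :+ y) :+ (z :+ w) := (a :* x :+ z) :+ (a :* y :+ w))
               refl a (coeff g n) (coeff h n) _ _ ⟩
    (a * coeff g n + coeff (0# ∷ (f *ₚ g)) n) + (a * coeff h n + coeff (0# ∷ (f *ₚ h)) n)
      ≈⟨ sym (+-cong (coeff-∷-*ₚ a f g n) (coeff-∷-*ₚ a f h n)) ⟩
    coeff ((a ∷ f) *ₚ g) n + coeff ((a ∷ f) *ₚ h) n
      ≈⟨ sym (coeff-+ ((a ∷ f) *ₚ g) ((a ∷ f) *ₚ h) n) ⟩
    coeff (((a ∷ f) *ₚ g) +ₚ ((a ∷ f) *ₚ h)) n ∎

  *ₚ-zeroʳ : ∀ f → f *ₚ [] ≋ []
  *ₚ-zeroʳ []      = ≋-refl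
  *ₚ-zeroʳ (a ∷ f) = mk λ { zero → refl ; (suc n) → get (*ₚ-zeroʳ f) n }

  *ₚ-∷ʳ : ∀ f b g → f *ₚ (b ∷ g) ≋ scale b f +ₚ (0# ∷ (f *ₚ g))
  *ₚ-∷ʳ []      b g = mk λ { zero → refl ; (suc n) → refl }
  *ₚ-∷ʳ (a ∷ f) b g = mk λ
    { zero    → trans (+-cong (*-comm a b) refl) (sym (coeff-+ (scale b (a ∷ f)) (0# ∷ ((a ∷ f) *ₚ g)) zero))
    ; (suc m) → begin
        coeff ((a ∷ f) *ₚ (b ∷ g)) (suc m)
          ≈⟨ coeff-+ (scale a (b ∷ g)) (0# ∷ (f *ₚ (b ∷ g))) (suc m) ⟩
        coeff (scale a (b ∷ g)) (suc m) + coeff (f *ₚ (b ∷ g)) m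
          ≈⟨ +-cong (coeff-scale a g m) (trans (get (*ₚ-∷ʳ f b g) m)
                    (trans (coeff-+ (scale b f) _ m) (+-cong (coeff-scale b f m) refl))) ⟩
        a * coeff g m + (b * coeff f m + coeff (0# ∷ (f *ₚ g)) m)
          ≈⟨ solve 3 (λ x y z → x :+ (y :+ z) := y :+ (x :+ z)) refl (a * coeff g m) (b * coeff f m) _ ⟩
        b * coeff f m + (a * coeff g m + coeff (0# ∷ (f *ₚ g)) m)
          ≈⟨ sym (+-cong (coeff-scale b f m) (coeff-∷-*ₚ a f g m)) ⟩
        coeff (scale b f) m + coeff ((a ∷ f) *ₚ g) m
          ≈⟨ sym (coeff-+ (scale b (a ∷ f)) (0# ∷ ((a ∷ f) *ₚ g)) (suc m)) ⟩
        coeff (scale b (a ∷ f) +ₚ (0# ∷ ((a ∷ f) *ₚ g))) (suc m) ∎ }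

  *ₚ-comm : ∀ f g → f *ₚ g ≋ g *ₚ f
  *ₚ-comm []      g = ≋-sym (*ₚ-zeroʳ g)
  *ₚ-comm (a ∷ f) g = ≋-trans (+ₚ-cong (≋-refl {scale a g}) (∷-cong refl (*ₚ-comm f g))) (≋-sym (*ₚ-∷ʳ g a f))

  scale-*ₚ : ∀ a g h → scale a g *ₚ h ≋ scale a (g *ₚ h)
  scale-*ₚ a []      h = ≋-refl
  scale-*ₚ a (b ∷ g) h = mk λ n → begin
    coeff (((a * b) ∷ scale a g) *ₚ h) n
      ≈⟨ coeff-∷-*ₚ (a * b) (scale a g) h n ⟩
    (a * b) * coeff h n + coeff (0# ∷ (scale a g *ₚ h)) n
      ≈⟨ +-cong refl (trans (get (∷-cong refl (scale-*ₚ a g h)) n) (coeff-0∷-scale a (g *ₚ h) n)) ⟩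
    (a * b) * coeff h n + a * coeff (0# ∷ (g *ₚ h)) n
      ≈⟨ solve 4 (λ a b x y → (a :* b) :* x :+ a :* y := a :* (b :* x :+ y)) refl a b (coeff h n) _ ⟩
    a * (b * coeff h n + coeff (0# ∷ (g *ₚ h)) n)
      ≈⟨ sym (trans (coeff-scale a ((b ∷ g) *ₚ h) n) (*-cong refl (coeff-∷-*ₚ b g h n))) ⟩
    coeff (scale a ((b ∷ g) *ₚ h)) n ∎

  0∷-*ₚ : ∀ f h → (0# ∷ f) *ₚ h ≋ 0# ∷ (f *ₚ h)
  0∷-*ₚ f h = mk λ n → trans (coeff-∷-*ₚ 0# f h n) (trans (+-cong (zeroˡ _) refl) (+-identityˡ _))

  *ₚ-assoc : ∀ f g h → (f *ₚ g) *ₚ h ≋ f *ₚ (g *ₚ h)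
  *ₚ-assoc []      g h = ≋-refl
  *ₚ-assoc (a ∷ f) g h =
    ≋-trans (*ₚ-distribʳ h (scale a g) (0# ∷ (f *ₚ g)))
      (+ₚ-cong (scale-*ₚ a g h) (≋-trans (0∷-*ₚ (f *ₚ g) h) (∷-cong refl (*ₚ-assoc f g h))))

  *ₚ-identityˡ : ∀ f → oneₚ *ₚ f ≋ f
  *ₚ-identityˡ f = mk λ n → trans (coeff-∷-*ₚ 1# [] f n) (trans (+-cong (*-identityˡ _) (coeff-[0] n)) (+-identityʳ _))

  *ₚ-identityʳ : ∀ f → f *ₚ oneₚ ≋ f
  *ₚ-identityʳ f = ≋-trans (*ₚ-comm f oneₚ) (*ₚ-identityˡ f)

  polynomialRing : CommutativeRing c ℓ
  polynomialRing = record
    { Carrier = Poly ; _≈_ = _≋_ ; _+_ = _+ₚ_ ; _*_ = _*ₚ_ ; -_ = negₚ ; 0# = [] ; 1# = oneₚ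
    ; isCommutativeRing = record
      { isRing = record
        { +-isAbelianGroup = record
          { isGroup = record
            { isMonoid = record
              { isSemigroup = record
                { isMagma = record
                  { isEquivalence = record { refl = ≋-refl ; sym = ≋-sym ; trans = ≋-trans }
                  ; ∙-cong = +ₚ-cong }
                ; assoc = +ₚ-assoc }
              ; identity = (λ _ → ≋-refl) , +ₚ-identityʳ }
            ; inverse = +ₚ-inverseˡ , +ₚ-inverseʳ
            ; ⁻¹-cong = negₚ-cong }
          ; comm = +ₚ-comm }
        ; *-cong = *ₚ-cong
        ; *-assoc = *ₚ-assoc
        ; *-identity = *ₚ-identityˡ , *ₚ-identityʳ
        ; distrib = *ₚ-distribˡ , *ₚ-distribʳ }
      ; *-comm = *ₚ-comm } }

module PolynomialDegree {c ℓ} (F : FiniteField c ℓ) where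
  open FiniteField F hiding (zero)
  open FF F
  open Polynomials F
  open import Relation.Binary.Reasoning.Setoid setoid

  DegBelow : ℕ → Poly → Set ℓ
  DegBelow k f = ∀ i → k ≤ i → coeff f i ≈ 0#

  DegBelow-mono : ∀ {k k′ f} → k ≤ k′ → DegBelow k f → DegBelow k′ f
  DegBelow-mono k≤k′ f<k i k′≤i = f<k i (ℕ.≤-trans k≤k′ k′≤i)

  DegBelow-resp-≋ : ∀ {k f g} → f ≋ g → DegBelow k f → DegBelow k g
  DegBelow-resp-≋ (mk f≈g) f<k i k≤i = trans (sym (f≈g i)) (f<k i k≤i)

  DegBelow-0⇒≋[] : ∀ {f} → DegBelow 0 f → f ≋ []
  DegBelow-0⇒≋[] f<0 = mk λ i → f<0 i z≤n

  isZeroᵇ-spec : ∀ a → (isZeroᵇ a ≡ true × a ≈ 0#) ⊎ (isZeroᵇ a ≡ false × ¬ a ≈ 0#)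
  isZeroᵇ-spec a with a ≟ 0#
  ... | yes a≈0 = inj₁ (≡.refl , a≈0)
  ... | no  a≉0 = inj₂ (≡.refl , a≉0)

  coeff-beyond-normalize : ∀ f i → length (normalize f) ≤ i → coeff f i ≈ 0#
  coeff-beyond-normalize []      i p = refl
  coeff-beyond-normalize (a ∷ f) i p with normalize f | coeff-beyond-normalize f
  ... | []     | ih with isZeroᵇ-spec a | i
  ...   | inj₁ (_ , a≈0)    | zero  = a≈0
  ...   | inj₁ _            | suc i = ih i z≤n
  ...   | inj₂ (a≢0 , _)    | zero  rewrite a≢0 with p
  ...     | ()
  coeff-beyond-normalize (a ∷ f) i p | [] | ih | inj₂ _ | suc i′ = ih i′ z≤n
  coeff-beyond-normalize (a ∷ f) zero    ()         | _ ∷ _ | ih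
  coeff-beyond-normalize (a ∷ f) (suc i) (s≤s p)    | _ ∷ _ | ih = ih i p

  coeff-last-normalize : ∀ f k → length (normalize f) ≡ suc k → ¬ coeff f k ≈ 0#
  coeff-last-normalize []      k ()
  coeff-last-normalize (a ∷ f) k p with normalize f | coeff-last-normalize f
  ... | []     | ih with isZeroᵇ-spec a | k
  ...   | inj₁ (a≡0 , _) | _     rewrite a≡0 with p
  ...     | ()
  coeff-last-normalize (a ∷ f) k p | [] | ih | inj₂ (_ , a≉0) | zero = a≉0
  coeff-last-normalize (a ∷ f) k p | [] | ih | inj₂ (a≢0 , _) | suc k′ rewrite a≢0 with p
  ... | ()
  coeff-last-normalize (a ∷ f) zero    ()  | _ ∷ _ | ih
  coeff-last-normalize (a ∷ f) (suc k) p   | _ ∷ _ | ih = ih k (ℕ.suc-injective p)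

  DegBelow-deg : ∀ f → DegBelow (suc (deg f)) f
  DegBelow-deg f i p with length (normalize f) | coeff-beyond-normalize f
  ... | zero  | beyond = beyond i z≤n
  ... | suc _ | beyond = beyond i p

  deg-unique : ∀ f e → ¬ coeff f e ≈ 0# → DegBelow (suc e) f → deg f ≡ e
  deg-unique f e fₑ≉0 f<e+1 with length (normalize f) in len | coeff-beyond-normalize f
  ... | zero  | beyond = ⊥-elim (fₑ≉0 (beyond e z≤n))
  ... | suc L | beyond with ℕ.<-cmp L e
  ... | tri< L<e _ _ = ⊥-elim (fₑ≉0 (beyond e L<e))
  ... | tri≈ _ L≡e _ = L≡e
  ... | tri> _ _ e<L = ⊥-elim (coeff-last-normalize f L len (f<e+1 L e<L))

  deg≡0⇒DegBelow-1 : ∀ f → deg f ≡ 0 → DegBelow 1 f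
  deg≡0⇒DegBelow-1 f deg≡0 i p with length (normalize f) | coeff-beyond-normalize f
  ... | zero     | beyond = beyond i z≤n
  ... | suc zero | beyond = beyond i p

  ≋[]? : ∀ f → Dec (f ≋ [])
  ≋[]? []      = yes ≋-refl
  ≋[]? (a ∷ f) with a ≟ 0# | ≋[]? f
  ... | yes a≈0 | yes f≋[] = yes (∷≋[] a≈0 f≋[])
  ... | no  a≉0 | _        = no (a≉0 ∘ ∷≋[]⇒head≈0)
  ... | yes _   | no  f≉[] = no (f≉[] ∘ ∷≋[]⇒tail≋[])

  exact-degree : ∀ f → ¬ f ≋ [] → Σ ℕ λ e → ¬ coeff f e ≈ 0# × DegBelow (suc e) f
  exact-degree []      f≉[] = ⊥-elim (f≉[] ≋-refl)
  exact-degree (a ∷ f) a∷f≉[] with ≋[]? f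
  ... | yes f≋[] = 0 , (λ a≈0 → a∷f≉[] (∷≋[] a≈0 f≋[])) , λ { zero () ; (suc i) _ → get f≋[] i }
  ... | no  f≉[] with exact-degree f f≉[]
  ... | e , fₑ≉0 , f<e+1 = suc e , fₑ≉0 , λ { zero () ; (suc i) (s≤s e<i) → f<e+1 i e<i }

  DegBelow⇒< : ∀ {k f e} → DegBelow k f → ¬ coeff f e ≈ 0# → e < k
  DegBelow⇒< {k} {f} {e} f<k fₑ≉0 with e ℕ.<? k
  ... | yes e<k = e<k
  ... | no  e≮k = ⊥-elim (fₑ≉0 (f<k e (ℕ.≮⇒≥ e≮k)))

  *-nonzero : ∀ {x y} → ¬ x ≈ 0# → ¬ y ≈ 0# → ¬ x * y ≈ 0#
  *-nonzero {x} {y} x≉0 y≉0 xy≈0 with inverse x x≉0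
  ... | x⁻¹ , xx⁻¹≈1 = y≉0 (begin
    y                ≈⟨ sym (*-identityˡ y) ⟩
    1# * y           ≈⟨ *-cong (trans (sym xx⁻¹≈1) (*-comm x x⁻¹)) refl ⟩
    (x⁻¹ * x) * y    ≈⟨ *-assoc x⁻¹ x y ⟩
    x⁻¹ * (x * y)    ≈⟨ *-cong refl xy≈0 ⟩
    x⁻¹ * 0#         ≈⟨ zeroʳ x⁻¹ ⟩
    0#               ∎)

  *ₚ-top : ∀ n m f g → DegBelow (suc n) f → DegBelow (suc m) g →
           DegBelow (suc (n ℕ.+ m)) (f *ₚ g) × coeff (f *ₚ g) (n ℕ.+ m) ≈ coeff f n * coeff g m
  *ₚ-top n       m []      g f<n+1 g<m+1 = (λ i _ → refl) , sym (zeroˡ _)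
  *ₚ-top zero    m (a ∷ f) g f<1   g<m+1 = below , top
    where
    tail≈0 : ∀ i → coeff (0# ∷ (f *ₚ g)) i ≈ 0#
    tail≈0 zero    = refl
    tail≈0 (suc i) = get (≋[]⇒*ₚ≋[] f g (mk λ j → f<1 (suc j) (s≤s z≤n))) i
    below : DegBelow (suc m) ((a ∷ f) *ₚ g)
    below i m<i = trans (coeff-∷-*ₚ a f g i)
      (trans (+-cong (trans (*-cong refl (g<m+1 i m<i)) (zeroʳ a)) (tail≈0 i)) (+-identityʳ 0#))
    top : coeff ((a ∷ f) *ₚ g) m ≈ a * coeff g m
    top = trans (coeff-∷-*ₚ a f g m) (trans (+-cong refl (tail≈0 m)) (+-identityʳ _))
  *ₚ-top (suc n) m (a ∷ f) g f<n+2 g<m+1 = below , top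
    where
    ih = *ₚ-top n m f g (λ i n<i → f<n+2 (suc i) (s≤s n<i)) g<m+1
    ag≈0 : ∀ i → m < i → a * coeff g i ≈ 0#
    ag≈0 i m<i = trans (*-cong refl (g<m+1 i m<i)) (zeroʳ a)
    below : DegBelow (suc (suc n ℕ.+ m)) ((a ∷ f) *ₚ g)
    below zero    ()
    below (suc i) (s≤s n+m<i) = trans (coeff-∷-*ₚ a f g (suc i))
      (trans (+-cong (ag≈0 (suc i) (s≤s (ℕ.≤-trans (ℕ.m≤n+m m n) (ℕ.≤-trans (ℕ.n≤1+n _) n+m<i))))
                     (proj₁ ih i n+m<i))
             (+-identityʳ 0#))
    top : coeff ((a ∷ f) *ₚ g) (suc n ℕ.+ m) ≈ coeff f n * coeff g m
    top = trans (coeff-∷-*ₚ a f g (suc n ℕ.+ m))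
      (trans (+-cong (ag≈0 (suc (n ℕ.+ m)) (s≤s (ℕ.m≤n+m m n))) (proj₂ ih)) (+-identityˡ _))

  *ₚ-nonzero : ∀ f g → ¬ f ≋ [] → ¬ g ≋ [] → ¬ f *ₚ g ≋ []
  *ₚ-nonzero f g f≉[] g≉[] fg≋[] with exact-degree f f≉[] | exact-degree g g≉[]
  ... | n , fₙ≉0 , f<n+1 | m , gₘ≉0 , g<m+1 =
    *-nonzero fₙ≉0 gₘ≉0 (trans (sym (proj₂ (*ₚ-top n m f g f<n+1 g<m+1))) (get fg≋[] (n ℕ.+ m)))

  ¬DegBelow-*ₚ : ∀ P n h → ¬ coeff P n ≈ 0# → DegBelow (suc n) P → ¬ h ≋ [] → ¬ DegBelow n (P *ₚ h)
  ¬DegBelow-*ₚ P n h Pₙ≉0 P<n+1 h≉[] Ph<n with exact-degree h h≉[]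
  ... | e , hₑ≉0 , h<e+1 = *-nonzero Pₙ≉0 hₑ≉0
    (trans (sym (proj₂ (*ₚ-top n e P h P<n+1 h<e+1))) (Ph<n (n ℕ.+ e) (ℕ.m≤m+n n e)))

module PolynomialDivision {c ℓ} (F : FiniteField c ℓ) where
  open FiniteField F hiding (zero)
  open FF F
  open Polynomials F
  open PolynomialDegree F
  module 𝔸 = CommutativeRing polynomialRing
  open import Algebra.Properties.Semiring.Divisibility 𝔸.semiring public
    using (_∣ˡ_; _,_; ∣ˡ-respʳ-≈; x∣ˡxy)
  open import Algebra.Properties.Ring 𝔸.ring using (x[y-z]≈xy-xz; [y-z]x≈yx-zx)
  open import Algebra.Properties.AbelianGroup 𝔸.+-abelianGroup using (xyx⁻¹≈y)
  open import Algebra.Properties.Group +-group using (ε⁻¹≈ε)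

  ∣ₚ⇒∣ˡ : ∀ {P f} → P ∣ₚ f → P ∣ˡ f
  ∣ₚ⇒∣ˡ (q , Pq≈f) = q , mk Pq≈f

  ∣ˡ⇒∣ₚ : ∀ {P f} → P ∣ˡ f → P ∣ₚ f
  ∣ˡ⇒∣ₚ (q , mk Pq≈f) = q , Pq≈f

  ∣ˡ-+ : ∀ {P f g} → P ∣ˡ f → P ∣ˡ g → P ∣ˡ f +ₚ g
  ∣ˡ-+ {P} (q , Pq≋f) (q′ , Pq′≋g) = q +ₚ q′ , ≋-trans (*ₚ-distribˡ P q q′) (+ₚ-cong Pq≋f Pq′≋g)

  ∣ˡ-− : ∀ {P f g} → P ∣ˡ f → P ∣ˡ g → P ∣ˡ f -ₚ g
  ∣ˡ-− {P} (q , Pq≋f) (q′ , Pq′≋g) = q -ₚ q′ , ≋-trans (x[y-z]≈xy-xz P q q′) (+ₚ-cong Pq≋f (negₚ-cong Pq′≋g))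

  ∣ˡ-*ˡ : ∀ {P} h {f} → P ∣ˡ f → P ∣ˡ h *ₚ f
  ∣ˡ-*ˡ {P} h (q , Pq≋f) =
    h *ₚ q , ≋-trans (solve 3 (λ P h q → P :* (h :* q) := h :* (P :* q)) ≋-refl P h q) (*ₚ-congʳ h _ _ Pq≋f)
    where open import Algebra.Solver.Ring.NaturalCoefficients.Default 𝔸.commutativeSemiring

  -- a ∷ f = m (c ∷ q) + (a ∷ r - c m), with c chosen to cancel the coefficient of θᵏ
  divide-by-monic : ∀ m k → coeff m k ≈ 1# → DegBelow (suc k) m → ∀ f →
                    Σ Poly λ q → Σ Poly λ r → f ≋ (m *ₚ q) +ₚ r × DegBelow k r
  divide-by-monic m k mₖ≈1 m<k+1 [] = [] , [] , ≋-sym (≋-trans (+ₚ-identityʳ _) (*ₚ-zeroʳ m)) , (λ i _ → refl)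
  divide-by-monic m k mₖ≈1 m<k+1 (a ∷ f) with divide-by-monic m k mₖ≈1 m<k+1 f
  ... | q , r , f≋mq+r , r<k = (c′ ∷ q) , r′ , a∷f≋ , r′<k
    where
    c′ = coeff (a ∷ r) k
    r′ = (a ∷ r) -ₚ scale c′ m
    coeff-r′ : ∀ i → coeff r′ i ≈ coeff (a ∷ r) i - c′ * coeff m i
    coeff-r′ i = trans (coeff-+ (a ∷ r) (negₚ (scale c′ m)) i)
                       (+-cong refl (trans (coeff-neg (scale c′ m) i) (-‿cong (coeff-scale c′ m i))))
    shifted : ∀ i → coeff (0# ∷ (m *ₚ q)) i + coeff (a ∷ r) i ≈ coeff (a ∷ f) i
    shifted zero    = +-identityˡ a
    shifted (suc i) = trans (sym (coeff-+ (m *ₚ q) r i)) (sym (get f≋mq+r i))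
    a∷f≋ : a ∷ f ≋ (m *ₚ (c′ ∷ q)) +ₚ r′
    a∷f≋ = mk λ i → sym (begin
      coeff ((m *ₚ (c′ ∷ q)) +ₚ r′) i
        ≈⟨ coeff-+ (m *ₚ (c′ ∷ q)) r′ i ⟩
      coeff (m *ₚ (c′ ∷ q)) i + coeff r′ i
        ≈⟨ +-cong (trans (get (*ₚ-∷ʳ m c′ q) i) (trans (coeff-+ (scale c′ m) _ i) (+-cong (coeff-scale c′ m i) refl)))
                  (coeff-r′ i) ⟩
      (c′ * coeff m i + coeff (0# ∷ (m *ₚ q)) i) + (coeff (a ∷ r) i - c′ * coeff m i)
        ≈⟨ cancel (c′ * coeff m i) _ _ ⟩
      coeff (0# ∷ (m *ₚ q)) i + coeff (a ∷ r) i
        ≈⟨ shifted i ⟩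
      coeff (a ∷ f) i ∎)
      where
      open import Relation.Binary.Reasoning.Setoid setoid
      open import Algebra.Solver.Ring.NaturalCoefficients.Default commutativeSemiring
      cancel : ∀ x y z → (x + y) + (z - x) ≈ y + z
      cancel x y z = begin
        (x + y) + (z - x)   ≈⟨ solve 4 (λ x y z -x → (x :+ y) :+ (z :+ -x) := (y :+ z) :+ (x :+ -x)) refl x y z (- x) ⟩
        (y + z) + (x - x)   ≈⟨ +-cong refl (-‿inverseʳ x) ⟩
        (y + z) + 0#        ≈⟨ +-identityʳ _ ⟩
        y + z               ∎
    r′<k : DegBelow k r′
    r′<k i k≤i with ℕ.m≤n⇒m<n∨m≡n k≤i
    ... | inj₂ ≡.refl = trans (coeff-r′ k) (trans (+-cong refl (-‿cong (trans (*-cong refl mₖ≈1) (*-identityʳ c′))))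
                                                   (-‿inverseʳ c′))
    ... | inj₁ (s≤s {n = j} k≤j) = trans (coeff-r′ (suc j))
      (trans (+-cong (r<k j k≤j) (-‿cong (trans (*-cong refl (m<k+1 (suc j) (s≤s k≤j))) (zeroʳ c′))))
             (trans (+-identityˡ _) ε⁻¹≈ε))

  +ₚ-≋[] : ∀ f {g} → g ≋ [] → f +ₚ g ≋ f
  +ₚ-≋[] f g≋[] = ≋-trans (+ₚ-cong (≋-refl {f}) g≋[]) (+ₚ-identityʳ f)

  [_]*ₚ : ∀ u f → (u ∷ []) *ₚ f ≋ scale u f
  [ u ]*ₚ f = mk λ i → trans (coeff-+ (scale u f) (0# ∷ []) i) (trans (+-cong refl (coeff-[0] i)) (+-identityʳ _))

  ∣ˡ-remainder : ∀ {P f g r} b → f ≋ g +ₚ r → P ∣ˡ f *ₚ b → P ∣ˡ g *ₚ b → P ∣ˡ r *ₚ b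
  ∣ˡ-remainder {f = f} {g} {r} b f≋g+r P∣fb P∣gb = ∣ˡ-respʳ-≈ rb≋fb-gb (∣ˡ-− P∣fb P∣gb)
    where
    rb≋fb-gb : (f *ₚ b) -ₚ (g *ₚ b) ≋ r *ₚ b
    rb≋fb-gb = ≋-trans (≋-sym ([y-z]x≈yx-zx b f g))
      (*ₚ-congˡ _ r b (≋-trans (+ₚ-cong f≋g+r (≋-refl {negₚ g})) (xyx⁻¹≈y g r)))

  module Irreducible (P : Poly) (n : ℕ) (Pₙ≈1 : coeff P n ≈ 1#) (P<n+1 : DegBelow (suc n) P)
    (irreducible : ∀ g h → (g *ₚ h) ≈ₚ P → deg g ≡ 0 ⊎ deg h ≡ 0) where

    1≉0 : ¬ 1# ≈ 0#
    1≉0 = 0≉1 ∘ sym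

    Pₙ≉0 : ¬ coeff P n ≈ 0#
    Pₙ≉0 = 1≉0 ∘ trans (sym Pₙ≈1)

    ¬∣ˡ-low : ∀ a d → d < n → coeff a d ≈ 1# → DegBelow (suc d) a → ¬ P ∣ˡ a
    ¬∣ˡ-low a d d<n a_d≈1 a<d+1 (g , Pg≋a) with ≋[]? g
    ... | yes g≋[] = 1≉0 (trans (sym a_d≈1)
      (trans (sym (get Pg≋a d)) (get (≋-trans (*ₚ-congʳ P g [] g≋[]) (*ₚ-zeroʳ P)) d)))
    ... | no  g≉[] = ¬DegBelow-*ₚ P n g Pₙ≉0 P<n+1 g≉[]
      (DegBelow-resp-≋ (≋-sym Pg≋a) (DegBelow-mono {f = a} d<n a<d+1))

    ∣ˡ? : Decidable (P ∣ˡ_)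
    ∣ˡ? f with divide-by-monic P n Pₙ≈1 P<n+1 f
    ... | q , r , f≋Pq+r , r<n with ≋[]? r
    ... | yes r≋[] = yes (q , ≋-sym (≋-trans f≋Pq+r (+ₚ-≋[] (P *ₚ q) r≋[])))
    ... | no  r≉[] = no λ (g , Pg≋f) → ¬DegBelow-*ₚ P n (g -ₚ q) Pₙ≉0 P<n+1
                                          (r≉[] ∘ ≋-trans (≋-sym (P[g-q]≋r g Pg≋f)) ∘ *ₚ≋[] P)
                                          (DegBelow-resp-≋ (≋-sym (P[g-q]≋r g Pg≋f)) r<n)
      where
      *ₚ≋[] : ∀ P {g} → g ≋ [] → P *ₚ g ≋ []
      *ₚ≋[] P g≋[] = ≋-trans (*ₚ-congʳ P _ [] g≋[]) (*ₚ-zeroʳ P)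
      P[g-q]≋r : ∀ g → P *ₚ g ≋ f → P *ₚ (g -ₚ q) ≋ r
      P[g-q]≋r g Pg≋f = ≋-trans (x[y-z]≈xy-xz P g q)
        (≋-trans (+ₚ-cong (≋-trans Pg≋f f≋Pq+r) (≋-refl {negₚ (P *ₚ q)})) (xyx⁻¹≈y (P *ₚ q) r))

    module Monic (a : Poly) (e : ℕ) (aₑ≉0 : ¬ coeff a e ≈ 0#) (a<e+1 : DegBelow (suc e) a) where
      u = proj₁ (inverse (coeff a e) aₑ≉0)
      m = scale u a

      mₑ≈1 : coeff m e ≈ 1#
      mₑ≈1 = trans (coeff-scale u a e) (trans (*-comm u _) (proj₂ (inverse (coeff a e) aₑ≉0)))

      m<e+1 : DegBelow (suc e) m
      m<e+1 i e<i = trans (coeff-scale u a i) (trans (*-cong refl (a<e+1 i e<i)) (zeroʳ u))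

      ∣ˡ-m*ₚ : ∀ b → P ∣ˡ a *ₚ b → P ∣ˡ m *ₚ b
      ∣ˡ-m*ₚ b P∣ab = ∣ˡ-respʳ-≈ (≋-trans ([ u ]*ₚ (a *ₚ b)) (≋-sym (scale-*ₚ u a b))) (∣ˡ-*ˡ (u ∷ []) P∣ab)

    -- dividing P by m leaves a nonzero remainder, as P is irreducible of larger degree than m
    smaller-multiplier : ∀ b e m → coeff m (suc e) ≈ 1# → DegBelow (suc (suc e)) m → suc e < n → P ∣ˡ m *ₚ b →
                         Σ Poly λ r → ¬ r ≋ [] × DegBelow (suc e) r × P ∣ˡ r *ₚ b
    smaller-multiplier b e m mₑ≈1 m<e+2 e<n P∣mb with divide-by-monic m (suc e) mₑ≈1 m<e+2 P
    ... | q , r , P≋mq+r , r<e+1 with ≋[]? r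
    ... | no r≉[] = r , r≉[] , r<e+1 ,
      ∣ˡ-remainder {g = m *ₚ q} {r} b P≋mq+r (x∣ˡxy P b) (∣ˡ-respʳ-≈ q[mb]≋[mq]b (∣ˡ-*ˡ q P∣mb))
      where
      open import Algebra.Solver.Ring.NaturalCoefficients.Default 𝔸.commutativeSemiring
      q[mb]≋[mq]b : q *ₚ (m *ₚ b) ≋ (m *ₚ q) *ₚ b
      q[mb]≋[mq]b = solve 3 (λ q m b → q :* (m :* b) := (m :* q) :* b) ≋-refl q m b
    ... | yes r≋[] with irreducible m q (get (≋-sym P≋mq))
      where P≋mq = ≋-trans P≋mq+r (+ₚ-≋[] (m *ₚ q) r≋[])
    ...   | inj₁ deg-m≡0 with ≡.trans (≡.sym deg-m≡0) (deg-unique m (suc e) (1≉0 ∘ trans (sym mₑ≈1)) m<e+2)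
    ...     | ()
    smaller-multiplier b e m mₑ≈1 m<e+2 e<n P∣mb | q , r , P≋mq+r , r<e+1 | yes r≋[] | inj₂ deg-q≡0 =
      ⊥-elim (Pₙ≉0 (trans (get P≋mq n)
        (proj₁ (*ₚ-top (suc e) 0 m q m<e+2 (deg≡0⇒DegBelow-1 q deg-q≡0)) n e+1<n)))
      where
      P≋mq = ≋-trans P≋mq+r (+ₚ-≋[] (m *ₚ q) r≋[])
      e+1<n : suc (suc e ℕ.+ 0) ≤ n
      e+1<n rewrite ℕ.+-identityʳ e = e<n

    ¬∣ˡ-*ₚ-below : ∀ b → ¬ P ∣ˡ b → ∀ k a → DegBelow k a → k ≤ n → ¬ a ≋ [] → ¬ P ∣ˡ a *ₚ b
    ¬∣ˡ-*ₚ-below b P∤b zero    a a<0   _   a≉[] _ = a≉[] (DegBelow-0⇒≋[] a<0)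
    ¬∣ˡ-*ₚ-below b P∤b (suc k) a a<k+1 k<n a≉[] P∣ab = by-degree (exact-degree a a≉[])
      where
      by-degree : Σ ℕ (λ e → ¬ coeff a e ≈ 0# × DegBelow (suc e) a) → ⊥
      by-degree (zero , a₀≉0 , a<1) =
        P∤b (∣ˡ-respʳ-≈ (≋-trans (*ₚ-congˡ m oneₚ b m≋1) (*ₚ-identityˡ b)) (∣ˡ-m*ₚ b P∣ab))
        where
        open Monic a zero a₀≉0 a<1
        m≋1 : m ≋ oneₚ
        m≋1 = mk λ { zero → mₑ≈1 ; (suc i) → m<e+1 (suc i) (s≤s z≤n) }
      by-degree (suc e , aₑ≉0 , a<e+2) =
        ¬∣ˡ-*ₚ-below b P∤b k r (DegBelow-mono {f = r} e+1≤k r<e+1) (ℕ.<⇒≤ k<n) r≉[] P∣rb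
        where
        open Monic a (suc e) aₑ≉0 a<e+2
        e+1≤k = ℕ.s≤s⁻¹ (DegBelow⇒< {f = a} a<k+1 aₑ≉0)
        reduced = smaller-multiplier b e m mₑ≈1 m<e+1 (ℕ.≤-<-trans e+1≤k k<n) (∣ˡ-m*ₚ b P∣ab)
        r = proj₁ reduced
        r≉[] = proj₁ (proj₂ reduced)
        r<e+1 = proj₁ (proj₂ (proj₂ reduced))
        P∣rb = proj₂ (proj₂ (proj₂ reduced))

    euclid : ∀ a b → ¬ P ∣ˡ a → ¬ P ∣ˡ b → ¬ P ∣ˡ a *ₚ b
    euclid a b P∤a P∤b P∣ab with divide-by-monic P n Pₙ≈1 P<n+1 a
    ... | q , r , a≋Pq+r , r<n with ≋[]? r
    ... | yes r≋[] = P∤a (q , ≋-sym (≋-trans a≋Pq+r (+ₚ-≋[] (P *ₚ q) r≋[])))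
    ... | no  r≉[] = ¬∣ˡ-*ₚ-below b P∤b n r r<n ℕ.≤-refl r≉[]
                       (∣ˡ-remainder {g = P *ₚ q} {r} b a≋Pq+r P∣ab
                         (∣ˡ-respʳ-≈ (≋-sym (*ₚ-assoc P q b)) (x∣ˡxy P (q *ₚ b))))

module MonicPolynomials {c ℓ} (F : FiniteField c ℓ) where
  open FiniteField F hiding (zero)
  open FF F
  open PolynomialDegree F

  tuples-length : ∀ d → All (λ t → length t ≡ d) (tuples d)
  tuples-length zero    = ≡.refl ∷ []
  tuples-length (suc d) =
    All.concat⁺ (All.map⁺ (All.universal (λ _ → All.map⁺ (All.map (≡.cong suc) (tuples-length d))) elements))

  monicOfDeg-all : ∀ {p} d (Pr : Poly → Set p) → (∀ t → length t ≡ d → Pr (t ++ [ 1# ])) → All Pr (monicOfDeg d)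
  monicOfDeg-all d Pr pr = All.map⁺ (All.map (λ {t} → pr t) (tuples-length d))

  monic-top : ∀ t d → length t ≡ d → coeff (t ++ [ 1# ]) d ≈ 1#
  monic-top []      zero    _   = refl
  monic-top (_ ∷ t) (suc d) len = monic-top t d (ℕ.suc-injective len)

  monic-DegBelow : ∀ t d → length t ≡ d → DegBelow (suc d) (t ++ [ 1# ])
  monic-DegBelow []      zero    _   (suc i) _         = refl
  monic-DegBelow (_ ∷ t) (suc d) len (suc i) (s≤s d<i) = monic-DegBelow t d (ℕ.suc-injective len) i d<i

  monicOfDeg-complete : ∀ d f → coeff f d ≈ 1# → DegBelow (suc d) f → Any (f ≈ₚ_) (monicOfDeg d)
  monicOfDeg-complete zero    []      f₀≈1 _      = ⊥-elim (0≉1 f₀≈1)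
  monicOfDeg-complete zero    (a ∷ f) f₀≈1 f<1    = here λ { zero → f₀≈1 ; (suc i) → f<1 (suc i) (s≤s z≤n) }
  monicOfDeg-complete (suc d) []      f≈1  _      = ⊥-elim (0≉1 f≈1)
  monicOfDeg-complete (suc d) (a ∷ f) f≈1  f<d+2  =
    Any.map⁺ (Any.concat⁺ (Any.map⁺ (Any.map (λ a≈x → Any.map⁺ (Any.map (cons a≈x) tail)) (complete a))))
    where
    tail : Any (λ t → f ≈ₚ (t ++ [ 1# ])) (tuples d)
    tail = Any.map⁻ (monicOfDeg-complete d f f≈1 (λ i d<i → f<d+2 (suc i) (s≤s d<i)))
    cons : ∀ {x t} → a ≈ x → f ≈ₚ (t ++ [ 1# ]) → (a ∷ f) ≈ₚ ((x ∷ t) ++ [ 1# ])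
    cons a≈x f≈t zero    = a≈x
    cons a≈x f≈t (suc i) = f≈t i

module PrimeIdeals {c ℓ} (F : FiniteField c ℓ) where
  open FiniteField F hiding (zero)
  open FF F
  open Polynomials F
  open PolynomialDegree F
  open PolynomialDivision F
  open MonicPolynomials F

  zeroIdeal : DecPrimeIdeal polynomialRing ℓ
  zeroIdeal = record
    { 𝔭        = _≋ []
    ; 𝔭-resp-≈ = λ f≋g f≋[] → ≋-trans (≋-sym f≋g) f≋[]
    ; 0∈𝔭      = ≋-refl
    ; 𝔭-+      = +ₚ-cong
    ; 𝔭-*ˡ     = λ h f≋[] → ≋-trans (*ₚ-congʳ h _ [] f≋[]) (*ₚ-zeroʳ h)
    ; 1∉𝔭      = λ 1≋[] → 0≉1 (sym (∷≋[]⇒head≈0 1≋[]))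
    ; 𝔭-prime  = λ {f} {g} → *ₚ-nonzero f g
    ; 𝔭?       = ≋[]?
    }

  monic≉[] : ∀ d → All (λ a → ¬ a ≋ []) (monicOfDeg d)
  monic≉[] d = monicOfDeg-all d _ λ t len t≋[] → 0≉1 (trans (sym (get t≋[] d)) (monic-top t d len))

  module _ (P : Poly) (irreducible : MonicIrreducible P) where
    open Irreducible P (deg P) (proj₁ irreducible) (DegBelow-deg P) (proj₂ (proj₂ irreducible))

    principalIdeal : DecPrimeIdeal polynomialRing (c ⊔ ℓ)
    principalIdeal = record
      { 𝔭        = P ∣ˡ_
      ; 𝔭-resp-≈ = ∣ˡ-respʳ-≈
      ; 0∈𝔭      = [] , *ₚ-zeroʳ P
      ; 𝔭-+      = ∣ˡ-+
      ; 𝔭-*ˡ     = ∣ˡ-*ˡ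
      ; 1∉𝔭      = ¬∣ˡ-low oneₚ 0 (proj₁ (proj₂ irreducible)) refl λ { zero () ; (suc i) _ → refl }
      ; 𝔭-prime  = λ {a} {b} → euclid a b
      ; 𝔭?       = ∣ˡ?
      }

    monic∤ : ∀ d → d < deg P → All (λ a → ¬ P ∣ˡ a) (monicOfDeg d)
    monic∤ d d<n = monicOfDeg-all d _ λ t len →
      ¬∣ˡ-low (t ++ [ 1# ]) d d<n (monic-top t d len) (monic-DegBelow t d len)

fracRawRing : ∀ {c ℓ} → FiniteField c ℓ → RawRing c c
fracRawRing F = record
  { Carrier = Frac ; _≈_ = _≡_ ; _+_ = _+f_ ; _*_ = _*f_ ; -_ = map₁ negₚ ; 0# = 0f ; 1# = 1f }
  where open FF F

module ResidueChainSums {c ℓ i} (F : FiniteField c ℓ) (𝔓 : DecPrimeIdeal (Polynomials.polynomialRing F) i)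
  (H : ℕ) (monic∉𝔭 : ∀ d → d < H → All (λ a → ¬ DecPrimeIdeal.𝔭 𝔓 a) (FF.monicOfDeg F d)) where
  open FiniteField F hiding (zero)
  open FF F
  open DecPrimeIdeal 𝔓
  open ResidueRing 𝔓 public

  representative : StrictHomomorphism (CommutativeRing.rawRing κ) (fracRawRing F)
  representative = record
    { ⟦_⟧ = proj₁
    ; ⟦+⟧ = λ _ _ → ≡.refl ; ⟦*⟧ = λ _ _ → ≡.refl ; ⟦-⟧ = λ _ → ≡.refl ; ⟦0⟧ = ≡.refl ; ⟦1⟧ = ≡.refl }

  pow∉𝔭 : ∀ {a} → ¬ 𝔭 a → ∀ k → ¬ 𝔭 (a ^ₚ k)
  pow∉𝔭 a∉𝔭 zero    = 1∉𝔭
  pow∉𝔭 a∉𝔭 (suc k) = 𝔭-prime a∉𝔭 (pow∉𝔭 a∉𝔭 k)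

  invPow∉𝔭 : ∀ {a} → ¬ 𝔭 a → ∀ s → ¬ 𝔭 (den (invPow a s))
  invPow∉𝔭 a∉𝔭 (+ k)    = pow∉𝔭 a∉𝔭 k
  invPow∉𝔭 a∉𝔭 -[1+ k ] = 1∉𝔭

  sumF∉𝔭 : (l : List X) (f : X → Frac) → All (λ x → ¬ 𝔭 (den (f x))) l → ¬ 𝔭 (den (sumF (map f l)))
  sumF∉𝔭 []      f []          = 1∉𝔭
  sumF∉𝔭 (x ∷ l) f (fx∉𝔭 ∷ fl) = 𝔭-prime fx∉𝔭 (sumF∉𝔭 l f fl)

  S∉𝔭 : ∀ d s → d < H → ¬ 𝔭 (den (S d s))
  S∉𝔭 d s d<H = sumF∉𝔭 (monicOfDeg d) _ (All.map (λ a∉𝔭 → invPow∉𝔭 a∉𝔭 s) (monic∉𝔭 d d<H))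

  -- S d s lies in the localisation for d < H; the value chosen for d ≥ H is never used.
  Sκ : ℕ → ℤ → Fraction
  Sκ d s with d ℕ.<? H
  ... | yes d<H = S d s , S∉𝔭 d s d<H
  ... | no  _   = 𝟘

  representative-Sκ : ∀ d s → d < H → proj₁ (Sκ d s) ≡ S d s
  representative-Sκ d s d<H with d ℕ.<? H
  ... | yes _   = ≡.refl
  ... | no  d≮H = ⊥-elim (d≮H d<H)

  open ChainSum F (CommutativeRing.rawRing κ) Sκ public
  open ChainSumIdentity F κ Sκ public using (splitSum-combination)
  module Representative = ChainSumMap F representative Sκ S H representative-Sκ

module Theorem {c ℓ} (F : FiniteField c ℓ) where
  open FiniteField F hiding (zero)
  open FF F
  open Polynomials F
  open PolynomialDegree F
  open PolynomialDivision F using (∣ₚ⇒∣ˡ; ∣ˡ⇒∣ₚ)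
  open MonicPolynomials F
  open PrimeIdeals F
  open ChainSum F (fracRawRing F) S using (linearCombination)
  open ≡.≡-Reasoning

  module κ₀ (N : ℕ) = ResidueChainSums F zeroIdeal N (λ d _ → monic≉[] d)

  module κ[_] (P : Poly) (irreducible : MonicIrreducible P) =
    ResidueChainSums F (principalIdeal P irreducible) (deg P) (monic∤ P irreducible)

  toK : Σ Frac (λ x → ¬ den x ≋ []) → K
  toK (x , den≉[]) = x , den≉[] ∘ mk

  coefficients : List ℤ → ℕ → ℕ → List (K × List ℤ)
  coefficients s M N = map (map₁ toK) (κ₀.splitCombination N s M N)

  coefficients-depth : ∀ s M N → All (λ (_ , u) → length u ≤ length s) (coefficients s M N)
  coefficients-depth s M N =
    All.map⁺ (All.map⁺ (All.map (λ u≤ → ℕ.≤-trans u≤ take≤) (κ₀.combination-depth N N (take M s))))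
    where take≤ = ℕ.≤-trans (ℕ.≤-reflexive (List.length-take M s)) (ℕ.m⊓n≤n M (length s))

  exceptional : ℕ → List Poly
  exceptional N = concatMap monicOfDeg (upTo (suc N))

  N<deg-outside-exceptional : ∀ N P → MonicIrreducible P → ¬ Any (P ≈ₚ_) (exceptional N) → N < deg P
  N<deg-outside-exceptional N P (Pₙ≈1 , _) P∉E with N ℕ.<? deg P
  ... | yes N<n = N<n
  ... | no  N≮n = ⊥-elim (P∉E (Any.concat⁺ (Any.map⁺ {f = monicOfDeg}
          (Any.map (λ { ≡.refl → monicOfDeg-complete (deg P) P Pₙ≈1 (DegBelow-deg P) })
                   (∈-upTo⁺ (s≤s (ℕ.≮⇒≥ N≮n)))))))

  ≃⇒SameModP : ∀ P irreducible x y → κ[_]._≃_ P irreducible x y → SameModP P (proj₁ x) (proj₁ y)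
  ≃⇒SameModP P _ (_ , x∉P) (_ , y∉P) x≃y = x∉P ∘ ∣ₚ⇒∣ˡ , y∉P ∘ ∣ₚ⇒∣ˡ , ∣ˡ⇒∣ₚ x≃y

  representative-combination : ∀ s M N P (irreducible : MonicIrreducible P) → N ≤ deg P →
    proj₁ (κ[_].linearCombination P irreducible (κ[_].splitCombination P irreducible s M N) (deg P))
    ≡ sumF (map (λ (a , u) → proj₁ a *f ζcomp u P) (coefficients s M N))
  representative-combination s M N P irreducible N≤n = begin
    proj₁ (κP.linearCombination (κP.splitCombination s M N) (deg P))
      ≡⟨ κP.Representative.⟦linearCombination⟧ (κP.splitCombination s M N) (deg P) ℕ.≤-refl ⟩
    linearCombination (map (map₁ proj₁) (κP.splitCombination s M N)) (deg P)
      ≡⟨ ≡.cong (λ L → linearCombination L (deg P))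
           (≡.trans (κP.Representative.⟦splitCombination⟧ s M N N≤n)
                    (≡.sym (κ₀.Representative.⟦splitCombination⟧ N s M N ℕ.≤-refl))) ⟩
    linearCombination (map (map₁ proj₁) (κ₀.splitCombination N s M N)) (deg P)
      ≡⟨ ≡.cong sumF (≡.trans (≡.sym (List.map-∘ L₀)) (List.map-∘ L₀)) ⟩
    sumF (map (λ (a , u) → proj₁ a *f ζcomp u P) (coefficients s M N)) ∎
    where
    module κP = κ[_] P irreducible
    L₀ = κ₀.splitCombination N s M N

  splitComp≡combination-mod : ∀ s M N P (irreducible : MonicIrreducible P) → ¬ Any (P ≈ₚ_) (exceptional N) →
    SameModP P (splitComp s M N P) (sumF (map (λ (a , u) → proj₁ a *f ζcomp u P) (coefficients s M N)))
  splitComp≡combination-mod s M N P irreducible P∉E =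
    ≡.subst₂ (SameModP P) (κP.Representative.⟦splitSum⟧ s M N (deg P) ℕ.≤-refl)
                          (representative-combination s M N P irreducible N≤n)
             (≃⇒SameModP P irreducible (κP.splitSum s M N (deg P))
               (κP.linearCombination (κP.splitCombination s M N) (deg P))
               (κP.splitSum-combination N s M (deg P) N≤n))
    where
    module κP = κ[_] P irreducible
    N≤n = ℕ.<⇒≤ (N<deg-outside-exceptional N P irreducible P∉E)

lemmaA2 : ∀ {c ℓ : Level} (F : FiniteField c ℓ) (s : List ℤ) (M N : ℕ) →
          M ≤ length s →
          FF.KLinCombFMZV F (length s) (FF.splitComp F s M N)
lemmaA2 F s M N _ =
  coefficients s M N , coefficients-depth s M N , exceptional N , splitComp≡combination-mod s M N
  where open Theorem F
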